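{- For every sequent $S$: there is an $\mathcal{E}$-free $mv\mathbf{LKIE}$-derivation of $S$ if and only if there is a $\mathbf{PA}$-calculus proof of $S$.
   Context: Setting: equational theory $\mathcal{E}_{\mathrm{PA}}$: $\hat a(s(n),\beta)=s(\hat a(n,\beta))$, $\hat a(0,\beta)=\beta$, $\hat m(s(n),\beta)=\hat a(\hat m(n,\beta),\beta)$, $\hat m(0,\beta)=0$; axioms $\mathrm{Ax}_{\mathrm{PA}}$ of Takeuti's sequent calculus for Peano arithmetic with equality axioms; equality is the only predicate. Numeric terms may contain active parameters ($n,\dots$), passive parameters ($\boldsymbol{\alpha},\dots$; these may be quantified) and internal parameters ($\mathbf{m},\dots$). $mv\mathbf{LKIE}$ is $\mathbf{LK}$ over this language with the $\mathcal{E}$ rule (replace $t$ by $t'$ when $\mathcal{E}\models t=t'$) and the induction rule: from $F(n,\mathbf{m}_1,\dots,\mathbf{m}_\alpha),\Gamma\vdash\Delta,F(s(n),\mathbf{m}_1,\dots,\mathbf{m}_\alpha)$ infer $F(0,\mathbf{a}_1,\dots,\mathbf{a}_\alpha),\Gamma\vdash\Delta,F(t,\mathbf{a}_1,\dots,\mathbf{a}_\alpha)$ ($n$ active, $\mathbf{m}_i$ internal, $\mathbf{a}_i,t$ arbitrary schematic terms, at most one active parameter per sequent). $\mathcal{E}$-free means the $\mathcal{E}$ rule is not used. The $\mathbf{PA}$-calculus is Takeuti's sequent calculus for Peano arithmetic (axioms $\mathrm{Ax}_{\mathrm{PA}}$ and the ordinary induction rule). -}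

module Defs where

open import Data.Nat using (ℕ; zero; suc; _≟_)
open import Data.Fin using (Fin) renaming (zero to fz; suc to fs)
open import Data.List using (List; []; _∷_; _++_; _∷ʳ_)
open import Data.List.Relation.Unary.Any using (Any)
open import Data.List.Relation.Unary.All using (All)
open import Data.Product using (_×_; _,_; proj₁)
open import Data.Sum using (_⊎_)
open import Data.Unit using (⊤)
open import Relation.Nullary using (¬_; yes; no)
open import Relation.Binary.PropositionalEquality using (_≡_)

-- Language: sorts of parameters, terms, formulas (locally nameless:
-- bound variables are de Bruijn indices, free parameters are named).

data Sort : Set where
  act : Sort
  pas : Sort   -- passive parameters α, ... (may be quantified)
  int : Sort

data Term (k : ℕ) : Set where
  par : Sort → ℕ → Term k
  bv  : Fin k → Term k
  `0  : Term k
  `s  : Term k → Term k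
  â   : Term k → Term k → Term k
  m̂   : Term k → Term k → Term k

infix 4 _≐_
data Formula (k : ℕ) : Set where
  _≐_  : Term k → Term k → Formula k
  ¬'   : Formula k → Formula k
  _∧'_ : Formula k → Formula k → Formula k
  _∨'_ : Formula k → Formula k → Formula k
  _⊃'_ : Formula k → Formula k → Formula k
  ∀'   : Formula (suc k) → Formula k
  ∃'   : Formula (suc k) → Formula k

infix 3 _⇒_
data Seq : Set where
  _⇒_ : List (Formula 0) → List (Formula 0) → Seq

subT : ∀ {k j} → (Fin k → Term j) → Term k → Term j
subT σ (par s i) = par s i
subT σ (bv x)    = σ x
subT σ `0        = `0
subT σ (`s t)    = `s (subT σ t)
subT σ (â t u)   = â (subT σ t) (subT σ u)
subT σ (m̂ t u)   = m̂ (subT σ t) (subT σ u)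

wkT : ∀ {k} → Term k → Term (suc k)
wkT = subT (λ x → bv (fs x))

liftσ : ∀ {k j} → (Fin k → Term j) → Fin (suc k) → Term (suc j)
liftσ σ fz     = bv fz
liftσ σ (fs x) = wkT (σ x)

subF : ∀ {k j} → (Fin k → Term j) → Formula k → Formula j
subF σ (t ≐ u)  = subT σ t ≐ subT σ u
subF σ (¬' A)   = ¬' (subF σ A)
subF σ (A ∧' B) = subF σ A ∧' subF σ B
subF σ (A ∨' B) = subF σ A ∨' subF σ B
subF σ (A ⊃' B) = subF σ A ⊃' subF σ B
subF σ (∀' A)   = ∀' (subF (liftσ σ) A)
subF σ (∃' A)   = ∃' (subF (liftσ σ) A)

inst : Formula 1 → Term 0 → Formula 0
inst F t = subF (λ _ → t) F

emb : ∀ {k} → Term 0 → Term k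
emb = subT (λ ())

PSub : Set
PSub = Sort → ℕ → Term 0

psubT : ∀ {k} → PSub → Term k → Term k
psubT ρ (par s i) = emb (ρ s i)
psubT ρ (bv x)    = bv x
psubT ρ `0        = `0
psubT ρ (`s t)    = `s (psubT ρ t)
psubT ρ (â t u)   = â (psubT ρ t) (psubT ρ u)
psubT ρ (m̂ t u)   = m̂ (psubT ρ t) (psubT ρ u)

psubF : ∀ {k} → PSub → Formula k → Formula k
psubF ρ (t ≐ u)  = psubT ρ t ≐ psubT ρ u
psubF ρ (¬' A)   = ¬' (psubF ρ A)
psubF ρ (A ∧' B) = psubF ρ A ∧' psubF ρ B
psubF ρ (A ∨' B) = psubF ρ A ∨' psubF ρ B
psubF ρ (A ⊃' B) = psubF ρ A ⊃' psubF ρ B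
psubF ρ (∀' A)   = ∀' (psubF ρ A)
psubF ρ (∃' A)   = ∃' (psubF ρ A)

single : Sort → ℕ → Term 0 → PSub
single act i u act j with j ≟ i
... | yes _ = u
... | no  _ = par act j
single pas i u pas j with j ≟ i
... | yes _ = u
... | no  _ = par pas j
single int i u int j with j ≟ i
... | yes _ = u
... | no  _ = par int j
single _ i u s j = par s j

-- substitution used in the conclusion of the mvLKIE induction rule:
-- active n ↦ u, internal m_i ↦ a_i for the pairs (m_i , a_i) in the list.
lookupInt : List (ℕ × Term 0) → ℕ → Term 0
lookupInt [] j = par int j
lookupInt ((m , a) ∷ L) j with j ≟ m
... | yes _ = a
... | no  _ = lookupInt L j

indSub : ℕ → Term 0 → List (ℕ × Term 0) → PSub
indSub n u L act j with j ≟ n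
... | yes _ = u
... | no  _ = par act j
indSub n u L pas j = par pas j
indSub n u L int j = lookupInt L j

data OccT {k} (s : Sort) (i : ℕ) : Term k → Set where
  here : OccT s i (par s i)
  s₁   : ∀ {t} → OccT s i t → OccT s i (`s t)
  â₁   : ∀ {t u} → OccT s i t → OccT s i (â t u)
  â₂   : ∀ {t u} → OccT s i u → OccT s i (â t u)
  m̂₁   : ∀ {t u} → OccT s i t → OccT s i (m̂ t u)
  m̂₂   : ∀ {t u} → OccT s i u → OccT s i (m̂ t u)

data OccF {k} (s : Sort) (i : ℕ) : Formula k → Set where
  ≐₁ : ∀ {t u} → OccT s i t → OccF s i (t ≐ u)
  ≐₂ : ∀ {t u} → OccT s i u → OccF s i (t ≐ u)
  ¬₁ : ∀ {A} → OccF s i A → OccF s i (¬' A)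
  ∧₁ : ∀ {A B} → OccF s i A → OccF s i (A ∧' B)
  ∧₂ : ∀ {A B} → OccF s i B → OccF s i (A ∧' B)
  ∨₁ : ∀ {A B} → OccF s i A → OccF s i (A ∨' B)
  ∨₂ : ∀ {A B} → OccF s i B → OccF s i (A ∨' B)
  ⊃₁ : ∀ {A B} → OccF s i A → OccF s i (A ⊃' B)
  ⊃₂ : ∀ {A B} → OccF s i B → OccF s i (A ⊃' B)
  ∀₁ : ∀ {A} → OccF s i A → OccF s i (∀' A)
  ∃₁ : ∀ {A} → OccF s i A → OccF s i (∃' A)

OccSeq : Sort → ℕ → Seq → Set
OccSeq s i (Γ ⇒ Δ) = Any (OccF s i) Γ ⊎ Any (OccF s i) Δ

OneActive : Seq → Set
OneActive S = ∀ i j → OccSeq act i S → OccSeq act j S → i ≡ j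

-- Ax_PA: Takeuti's initial sequents of PA with equality axioms
-- (defining equations oriented as in 𝓔_PA: recursion on the 1st argument)

data AxPA : Seq → Set where
  eq-refl : ∀ t → AxPA ([] ⇒ (t ≐ t) ∷ [])
  eq-s    : ∀ t u → AxPA ((t ≐ u) ∷ [] ⇒ (`s t ≐ `s u) ∷ [])
  eq-â    : ∀ t₁ u₁ t₂ u₂ → AxPA ((t₁ ≐ u₁) ∷ (t₂ ≐ u₂) ∷ [] ⇒ (â t₁ t₂ ≐ â u₁ u₂) ∷ [])
  eq-m̂    : ∀ t₁ u₁ t₂ u₂ → AxPA ((t₁ ≐ u₁) ∷ (t₂ ≐ u₂) ∷ [] ⇒ (m̂ t₁ t₂ ≐ m̂ u₁ u₂) ∷ [])
  eq-pred : ∀ t₁ u₁ t₂ u₂ → AxPA ((t₁ ≐ u₁) ∷ (t₂ ≐ u₂) ∷ (t₁ ≐ t₂) ∷ [] ⇒ (u₁ ≐ u₂) ∷ [])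
  s≢0     : ∀ t → AxPA ((`s t ≐ `0) ∷ [] ⇒ [])
  s-inj   : ∀ t u → AxPA ((`s t ≐ `s u) ∷ [] ⇒ (t ≐ u) ∷ [])
  â-0     : ∀ b → AxPA ([] ⇒ (â `0 b ≐ b) ∷ [])
  â-s     : ∀ t b → AxPA ([] ⇒ (â (`s t) b ≐ `s (â t b)) ∷ [])
  m̂-0     : ∀ b → AxPA ([] ⇒ (m̂ `0 b ≐ `0) ∷ [])
  m̂-s     : ∀ t b → AxPA ([] ⇒ (m̂ (`s t) b ≐ â (m̂ t b) b) ∷ [])

-- The rules of LK (Takeuti) other than induction, with initial sequents.
-- 'Eig' says which sorts of parameters may serve as eigenvariables.

data Rule (Eig : Sort → Set) : List Seq → Seq → Set where
  init  : ∀ A → Rule Eig [] (A ∷ [] ⇒ A ∷ [])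
  axiom : ∀ {S} → AxPA S → Rule Eig [] S
  wL    : ∀ {Γ Δ} A → Rule Eig ((Γ ⇒ Δ) ∷ []) (A ∷ Γ ⇒ Δ)
  wR    : ∀ {Γ Δ} A → Rule Eig ((Γ ⇒ Δ) ∷ []) (Γ ⇒ Δ ∷ʳ A)
  cL    : ∀ {Γ Δ A} → Rule Eig ((A ∷ A ∷ Γ ⇒ Δ) ∷ []) (A ∷ Γ ⇒ Δ)
  cR    : ∀ {Γ Δ A} → Rule Eig ((Γ ⇒ Δ ∷ʳ A ∷ʳ A) ∷ []) (Γ ⇒ Δ ∷ʳ A)
  eL    : ∀ {Γ Π Δ A B} → Rule Eig ((Γ ++ A ∷ B ∷ Π ⇒ Δ) ∷ []) (Γ ++ B ∷ A ∷ Π ⇒ Δ)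
  eR    : ∀ {Γ Δ Λ A B} → Rule Eig ((Γ ⇒ Δ ++ A ∷ B ∷ Λ) ∷ []) (Γ ⇒ Δ ++ B ∷ A ∷ Λ)
  cut   : ∀ {Γ Δ Π Λ} A → Rule Eig ((Γ ⇒ Δ ∷ʳ A) ∷ (A ∷ Π ⇒ Λ) ∷ []) (Γ ++ Π ⇒ Δ ++ Λ)
  ¬L    : ∀ {Γ Δ A} → Rule Eig ((Γ ⇒ Δ ∷ʳ A) ∷ []) (¬' A ∷ Γ ⇒ Δ)
  ¬R    : ∀ {Γ Δ A} → Rule Eig ((A ∷ Γ ⇒ Δ) ∷ []) (Γ ⇒ Δ ∷ʳ ¬' A)
  ∧L₁   : ∀ {Γ Δ A} B → Rule Eig ((A ∷ Γ ⇒ Δ) ∷ []) ((A ∧' B) ∷ Γ ⇒ Δ)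
  ∧L₂   : ∀ {Γ Δ B} A → Rule Eig ((B ∷ Γ ⇒ Δ) ∷ []) ((A ∧' B) ∷ Γ ⇒ Δ)
  ∧R    : ∀ {Γ Δ A B} → Rule Eig ((Γ ⇒ Δ ∷ʳ A) ∷ (Γ ⇒ Δ ∷ʳ B) ∷ []) (Γ ⇒ Δ ∷ʳ (A ∧' B))
  ∨L    : ∀ {Γ Δ A B} → Rule Eig ((A ∷ Γ ⇒ Δ) ∷ (B ∷ Γ ⇒ Δ) ∷ []) ((A ∨' B) ∷ Γ ⇒ Δ)
  ∨R₁   : ∀ {Γ Δ A} B → Rule Eig ((Γ ⇒ Δ ∷ʳ A) ∷ []) (Γ ⇒ Δ ∷ʳ (A ∨' B))
  ∨R₂   : ∀ {Γ Δ B} A → Rule Eig ((Γ ⇒ Δ ∷ʳ B) ∷ []) (Γ ⇒ Δ ∷ʳ (A ∨' B))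
  ⊃L    : ∀ {Γ Δ Π Λ A B} → Rule Eig ((Γ ⇒ Δ ∷ʳ A) ∷ (B ∷ Π ⇒ Λ) ∷ []) ((A ⊃' B) ∷ Γ ++ Π ⇒ Δ ++ Λ)
  ⊃R    : ∀ {Γ Δ A B} → Rule Eig ((A ∷ Γ ⇒ Δ ∷ʳ B) ∷ []) (Γ ⇒ Δ ∷ʳ (A ⊃' B))
  ∀L    : ∀ {Γ Δ F} (t : Term 0) → Rule Eig ((inst F t ∷ Γ ⇒ Δ) ∷ []) (∀' F ∷ Γ ⇒ Δ)
  ∀R    : ∀ {Γ Δ F} s a → Eig s → ¬ OccSeq s a (Γ ⇒ Δ ∷ʳ ∀' F) →
          Rule Eig ((Γ ⇒ Δ ∷ʳ inst F (par s a)) ∷ []) (Γ ⇒ Δ ∷ʳ ∀' F)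
  ∃L    : ∀ {Γ Δ F} s a → Eig s → ¬ OccSeq s a (∃' F ∷ Γ ⇒ Δ) →
          Rule Eig ((inst F (par s a) ∷ Γ ⇒ Δ) ∷ []) (∃' F ∷ Γ ⇒ Δ)
  ∃R    : ∀ {Γ Δ F} (t : Term 0) → Rule Eig ((Γ ⇒ Δ ∷ʳ inst F t) ∷ []) (Γ ⇒ Δ ∷ʳ ∃' F)

-- 𝓔-free mvLKIE derivations: LK rules (only passive parameters are
-- quantified), plus the schematic induction rule; every sequent has at
-- most one active parameter.

Passive : Sort → Set
Passive s = s ≡ pas

data MVLKIE-EFree : Seq → Set where
  rule : ∀ {ps S} → Rule Passive ps S → OneActive S →
         All MVLKIE-EFree ps → MVLKIE-EFree S
  -- F(n, m_1..m_α), Γ ⊢ Δ, F(s(n), m_1..m_α)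
  -- F(0, a_1..a_α), Γ ⊢ Δ, F(t, a_1..a_α)
  -- L lists the pairs (m_i , a_i) of internal parameters and terms.
  ind  : ∀ (F : Formula 0) (n : ℕ) (L : List (ℕ × Term 0)) (t : Term 0) Γ Δ →
         ¬ OccSeq act n (Γ ⇒ Δ) →
         All (λ p → ¬ OccSeq int (proj₁ p) (Γ ⇒ Δ)) L →
         OneActive (psubF (indSub n `0 L) F ∷ Γ ⇒ Δ ∷ʳ psubF (indSub n t L) F) →
         MVLKIE-EFree (F ∷ Γ ⇒ Δ ∷ʳ psubF (single act n (`s (par act n))) F) →
         MVLKIE-EFree (psubF (indSub n `0 L) F ∷ Γ ⇒ Δ ∷ʳ psubF (indSub n t L) F)

-- PA-calculus proofs (Takeuti): all parameters are ordinary free variables.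

AnySort : Sort → Set
AnySort _ = ⊤

data PAProof : Seq → Set where
  rule : ∀ {ps S} → Rule AnySort ps S → All PAProof ps → PAProof S
  ind  : ∀ (F : Formula 0) s a (t : Term 0) Γ Δ →
         ¬ OccSeq s a (Γ ⇒ Δ) →
         PAProof (F ∷ Γ ⇒ Δ ∷ʳ psubF (single s a (`s (par s a))) F) →
         PAProof (psubF (single s a `0) F ∷ Γ ⇒ Δ ∷ʳ psubF (single s a t) F)

-- The two calculi share their logical rules and both admit substitution of
-- terms for parameters without induction on derivations: Γ ⊢ Δ yields
-- ⊢ ∀x (⋀Γ ⊃ ⋁Δ)[x/a] by ∀R, hence every instance by ∀L and cut, and a
-- simultaneous substitution is a chain of single ones through fresh passive
-- parameters. So the schematic induction of mvLKIE is PA induction on a fresh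
-- passive parameter followed by a substitution. Conversely, renaming the
-- parameters of a PA proof injectively to passive ones leaves no active
-- parameter and makes every eigenvariable passive, so each rule becomes an
-- mvLKIE rule and each PA induction a schematic induction on the active
-- parameter 0; a final substitution undoes the renaming and introduces only
-- the one active parameter of the end sequent.

module Submission where

open import Defs
open import Function.Base using (_∘_)
open import Function.Bundles using (_⇔_; mk⇔)
open import Data.Nat using (ℕ; zero; suc; _≟_; _≤_; _⊔_; s≤s)
open import Data.Nat.Properties using (≤-trans; ≤-refl; m≤m⊔n; m≤n⊔m; 1+n≰n)
open import Data.Fin using (Fin; fromℕ; inject₁) renaming (zero to fz; suc to fs)
open import Data.List using (List; []; _∷_; _++_; _∷ʳ_; map; [_]; upTo)
open import Data.List.Properties using (++-assoc; ++-identityʳ; map-++)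
open import Data.List.Relation.Unary.Any using (Any; here; there)
open import Data.List.Relation.Unary.Any.Properties using (++⁺ˡ; ++⁺ʳ) renaming (++⁻ to Any-++⁻)
open import Data.List.Relation.Unary.All as All using (All; []; _∷_)
open import Data.List.Relation.Unary.All.Properties using (++⁺) renaming (map⁺ to All-map⁺)
open import Data.List.Membership.Propositional using (_∈_)
open import Data.List.Membership.Propositional.Properties using (∈-map⁺; ∈-upTo⁺)
open import Data.Product using (_×_; _,_; proj₁; proj₂; ∃₂; map₁; map₂)
open import Data.Product.Properties using (≡-dec)
open import Data.Sum using (_⊎_; inj₁; inj₂; [_,_]′) renaming (map to ⊎-map)
open import Data.Unit using (⊤; tt)
open import Data.Empty using (⊥; ⊥-elim)
open import Relation.Nullary using (¬_; yes; no)
open import Relation.Binary.Definitions using (DecidableEquality)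
open import Relation.Binary.PropositionalEquality
  using (_≡_; _≢_; refl; sym; trans; cong; cong₂; subst; subst₂; module ≡-Reasoning)

_≟ₛ_ : DecidableEquality Sort
act ≟ₛ act = yes refl
act ≟ₛ pas = no λ ()
act ≟ₛ int = no λ ()
pas ≟ₛ act = no λ ()
pas ≟ₛ pas = yes refl
pas ≟ₛ int = no λ ()
int ≟ₛ act = no λ ()
int ≟ₛ pas = no λ ()
int ≟ₛ int = yes refl

_≟ₚ_ : DecidableEquality (Sort × ℕ)
_≟ₚ_ = ≡-dec _≟ₛ_ _≟_

subT-cong : ∀ {k j} {σ τ : Fin k → Term j} → (∀ x → σ x ≡ τ x) → ∀ t → subT σ t ≡ subT τ t
subT-cong e (par s i) = refl
subT-cong e (bv x)    = e x
subT-cong e `0        = refl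
subT-cong e (`s t)    = cong `s (subT-cong e t)
subT-cong e (â t u)   = cong₂ â (subT-cong e t) (subT-cong e u)
subT-cong e (m̂ t u)   = cong₂ m̂ (subT-cong e t) (subT-cong e u)

subT-∘ : ∀ {k j l} (σ : Fin k → Term j) (τ : Fin j → Term l) t →
         subT τ (subT σ t) ≡ subT (subT τ ∘ σ) t
subT-∘ σ τ (par s i) = refl
subT-∘ σ τ (bv x)    = refl
subT-∘ σ τ `0        = refl
subT-∘ σ τ (`s t)    = cong `s (subT-∘ σ τ t)
subT-∘ σ τ (â t u)   = cong₂ â (subT-∘ σ τ t) (subT-∘ σ τ u)
subT-∘ σ τ (m̂ t u)   = cong₂ m̂ (subT-∘ σ τ t) (subT-∘ σ τ u)

subT-id : ∀ {k} (t : Term k) → subT bv t ≡ t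
subT-id (par s i) = refl
subT-id (bv x)    = refl
subT-id `0        = refl
subT-id (`s t)    = cong `s (subT-id t)
subT-id (â t u)   = cong₂ â (subT-id t) (subT-id u)
subT-id (m̂ t u)   = cong₂ m̂ (subT-id t) (subT-id u)

liftσ-cong : ∀ {k j} {σ τ : Fin k → Term j} → (∀ x → σ x ≡ τ x) → ∀ x → liftσ σ x ≡ liftσ τ x
liftσ-cong e fz     = refl
liftσ-cong e (fs x) = cong wkT (e x)

liftσ-∘ : ∀ {k j l} (σ : Fin k → Term j) (τ : Fin j → Term l) x →
          subT (liftσ τ) (liftσ σ x) ≡ liftσ (subT τ ∘ σ) x
liftσ-∘ σ τ fz     = refl
liftσ-∘ σ τ (fs x) = trans (subT-∘ _ (liftσ τ) (σ x)) (sym (subT-∘ τ _ (σ x)))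

subF-cong : ∀ {k j} {σ τ : Fin k → Term j} → (∀ x → σ x ≡ τ x) → ∀ A → subF σ A ≡ subF τ A
subF-cong e (t ≐ u)  = cong₂ _≐_ (subT-cong e t) (subT-cong e u)
subF-cong e (¬' A)   = cong ¬' (subF-cong e A)
subF-cong e (A ∧' B) = cong₂ _∧'_ (subF-cong e A) (subF-cong e B)
subF-cong e (A ∨' B) = cong₂ _∨'_ (subF-cong e A) (subF-cong e B)
subF-cong e (A ⊃' B) = cong₂ _⊃'_ (subF-cong e A) (subF-cong e B)
subF-cong e (∀' A)   = cong ∀' (subF-cong (liftσ-cong e) A)
subF-cong e (∃' A)   = cong ∃' (subF-cong (liftσ-cong e) A)

subF-∘ : ∀ {k j l} (σ : Fin k → Term j) (τ : Fin j → Term l) A →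
         subF τ (subF σ A) ≡ subF (subT τ ∘ σ) A
subF-∘ σ τ (t ≐ u)  = cong₂ _≐_ (subT-∘ σ τ t) (subT-∘ σ τ u)
subF-∘ σ τ (¬' A)   = cong ¬' (subF-∘ σ τ A)
subF-∘ σ τ (A ∧' B) = cong₂ _∧'_ (subF-∘ σ τ A) (subF-∘ σ τ B)
subF-∘ σ τ (A ∨' B) = cong₂ _∨'_ (subF-∘ σ τ A) (subF-∘ σ τ B)
subF-∘ σ τ (A ⊃' B) = cong₂ _⊃'_ (subF-∘ σ τ A) (subF-∘ σ τ B)
subF-∘ σ τ (∀' A)   = cong ∀' (trans (subF-∘ (liftσ σ) (liftσ τ) A) (subF-cong (liftσ-∘ σ τ) A))
subF-∘ σ τ (∃' A)   = cong ∃' (trans (subF-∘ (liftσ σ) (liftσ τ) A) (subF-cong (liftσ-∘ σ τ) A))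

subT-emb : ∀ {k j} (σ : Fin k → Term j) (u : Term 0) → subT σ (emb u) ≡ emb u
subT-emb σ u = trans (subT-∘ (λ ()) σ u) (subT-cong (λ ()) u)

emb-id : (u : Term 0) → emb u ≡ u
emb-id u = trans (subT-cong (λ ()) u) (subT-id u)

psubT-cong : ∀ {k} {ρ τ : PSub} (t : Term k) →
             (∀ s i → OccT s i t → ρ s i ≡ τ s i) → psubT ρ t ≡ psubT τ t
psubT-cong (par s i) e = cong emb (e s i here)
psubT-cong (bv x)    e = refl
psubT-cong `0        e = refl
psubT-cong (`s t)    e = cong `s (psubT-cong t λ s i → e s i ∘ s₁)
psubT-cong (â t u)   e = cong₂ â (psubT-cong t λ s i → e s i ∘ â₁) (psubT-cong u λ s i → e s i ∘ â₂)
psubT-cong (m̂ t u)   e = cong₂ m̂ (psubT-cong t λ s i → e s i ∘ m̂₁) (psubT-cong u λ s i → e s i ∘ m̂₂)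

psubF-cong : ∀ {k} {ρ τ : PSub} (A : Formula k) →
             (∀ s i → OccF s i A → ρ s i ≡ τ s i) → psubF ρ A ≡ psubF τ A
psubF-cong (t ≐ u)  e = cong₂ _≐_ (psubT-cong t λ s i → e s i ∘ ≐₁) (psubT-cong u λ s i → e s i ∘ ≐₂)
psubF-cong (¬' A)   e = cong ¬' (psubF-cong A λ s i → e s i ∘ ¬₁)
psubF-cong (A ∧' B) e = cong₂ _∧'_ (psubF-cong A λ s i → e s i ∘ ∧₁) (psubF-cong B λ s i → e s i ∘ ∧₂)
psubF-cong (A ∨' B) e = cong₂ _∨'_ (psubF-cong A λ s i → e s i ∘ ∨₁) (psubF-cong B λ s i → e s i ∘ ∨₂)
psubF-cong (A ⊃' B) e = cong₂ _⊃'_ (psubF-cong A λ s i → e s i ∘ ⊃₁) (psubF-cong B λ s i → e s i ∘ ⊃₂)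
psubF-cong (∀' A)   e = cong ∀' (psubF-cong A λ s i → e s i ∘ ∀₁)
psubF-cong (∃' A)   e = cong ∃' (psubF-cong A λ s i → e s i ∘ ∃₁)

psubT-id : ∀ {k} (t : Term k) → psubT par t ≡ t
psubT-id (par s i) = refl
psubT-id (bv x)    = refl
psubT-id `0        = refl
psubT-id (`s t)    = cong `s (psubT-id t)
psubT-id (â t u)   = cong₂ â (psubT-id t) (psubT-id u)
psubT-id (m̂ t u)   = cong₂ m̂ (psubT-id t) (psubT-id u)

psubF-id : ∀ {k} (A : Formula k) → psubF par A ≡ A
psubF-id (t ≐ u)  = cong₂ _≐_ (psubT-id t) (psubT-id u)
psubF-id (¬' A)   = cong ¬' (psubF-id A)
psubF-id (A ∧' B) = cong₂ _∧'_ (psubF-id A) (psubF-id B)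
psubF-id (A ∨' B) = cong₂ _∨'_ (psubF-id A) (psubF-id B)
psubF-id (A ⊃' B) = cong₂ _⊃'_ (psubF-id A) (psubF-id B)
psubF-id (∀' A)   = cong ∀' (psubF-id A)
psubF-id (∃' A)   = cong ∃' (psubF-id A)

psubF-idᵒ : ∀ {k} (ρ : PSub) (A : Formula k) →
            (∀ s i → OccF s i A → ρ s i ≡ par s i) → psubF ρ A ≡ A
psubF-idᵒ ρ A e = trans (psubF-cong A e) (psubF-id A)

psubT-subT : ∀ {k j} (ρ : PSub) (σ : Fin k → Term j) t →
             psubT ρ (subT σ t) ≡ subT (psubT ρ ∘ σ) (psubT ρ t)
psubT-subT ρ σ (par s i) = sym (subT-emb _ (ρ s i))
psubT-subT ρ σ (bv x)    = refl
psubT-subT ρ σ `0        = refl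
psubT-subT ρ σ (`s t)    = cong `s (psubT-subT ρ σ t)
psubT-subT ρ σ (â t u)   = cong₂ â (psubT-subT ρ σ t) (psubT-subT ρ σ u)
psubT-subT ρ σ (m̂ t u)   = cong₂ m̂ (psubT-subT ρ σ t) (psubT-subT ρ σ u)

psubT-liftσ : ∀ {k j} (ρ : PSub) (σ : Fin k → Term j) x →
              psubT ρ (liftσ σ x) ≡ liftσ (psubT ρ ∘ σ) x
psubT-liftσ ρ σ fz     = refl
psubT-liftσ ρ σ (fs x) = psubT-subT ρ _ (σ x)

psubF-subF : ∀ {k j} (ρ : PSub) (σ : Fin k → Term j) A →
             psubF ρ (subF σ A) ≡ subF (psubT ρ ∘ σ) (psubF ρ A)
psubF-subF ρ σ (t ≐ u)  = cong₂ _≐_ (psubT-subT ρ σ t) (psubT-subT ρ σ u)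
psubF-subF ρ σ (¬' A)   = cong ¬' (psubF-subF ρ σ A)
psubF-subF ρ σ (A ∧' B) = cong₂ _∧'_ (psubF-subF ρ σ A) (psubF-subF ρ σ B)
psubF-subF ρ σ (A ∨' B) = cong₂ _∨'_ (psubF-subF ρ σ A) (psubF-subF ρ σ B)
psubF-subF ρ σ (A ⊃' B) = cong₂ _⊃'_ (psubF-subF ρ σ A) (psubF-subF ρ σ B)
psubF-subF ρ σ (∀' A)   = cong ∀' (trans (psubF-subF ρ (liftσ σ) A) (subF-cong (psubT-liftσ ρ σ) (psubF ρ A)))
psubF-subF ρ σ (∃' A)   = cong ∃' (trans (psubF-subF ρ (liftσ σ) A) (subF-cong (psubT-liftσ ρ σ) (psubF ρ A)))

psubF-inst : (ρ : PSub) (F : Formula 1) (t : Term 0) → psubF ρ (inst F t) ≡ inst (psubF ρ F) (psubT ρ t)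
psubF-inst ρ F t = psubF-subF ρ (λ _ → t) F

psubT-emb : ∀ {k} (ρ : PSub) (u : Term 0) → psubT ρ (emb {k} u) ≡ emb (psubT ρ u)
psubT-emb ρ u = trans (psubT-subT ρ (λ ()) u) (subT-cong (λ ()) (psubT ρ u))

psubT-∘ : ∀ {k} (ρ τ : PSub) (t : Term k) → psubT ρ (psubT τ t) ≡ psubT (λ s i → psubT ρ (τ s i)) t
psubT-∘ ρ τ (par s i) = psubT-emb ρ (τ s i)
psubT-∘ ρ τ (bv x)    = refl
psubT-∘ ρ τ `0        = refl
psubT-∘ ρ τ (`s t)    = cong `s (psubT-∘ ρ τ t)
psubT-∘ ρ τ (â t u)   = cong₂ â (psubT-∘ ρ τ t) (psubT-∘ ρ τ u)
psubT-∘ ρ τ (m̂ t u)   = cong₂ m̂ (psubT-∘ ρ τ t) (psubT-∘ ρ τ u)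

psubF-∘ : ∀ {k} (ρ τ : PSub) (A : Formula k) → psubF ρ (psubF τ A) ≡ psubF (λ s i → psubT ρ (τ s i)) A
psubF-∘ ρ τ (t ≐ u)  = cong₂ _≐_ (psubT-∘ ρ τ t) (psubT-∘ ρ τ u)
psubF-∘ ρ τ (¬' A)   = cong ¬' (psubF-∘ ρ τ A)
psubF-∘ ρ τ (A ∧' B) = cong₂ _∧'_ (psubF-∘ ρ τ A) (psubF-∘ ρ τ B)
psubF-∘ ρ τ (A ∨' B) = cong₂ _∨'_ (psubF-∘ ρ τ A) (psubF-∘ ρ τ B)
psubF-∘ ρ τ (A ⊃' B) = cong₂ _⊃'_ (psubF-∘ ρ τ A) (psubF-∘ ρ τ B)
psubF-∘ ρ τ (∀' A)   = cong ∀' (psubF-∘ ρ τ A)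
psubF-∘ ρ τ (∃' A)   = cong ∃' (psubF-∘ ρ τ A)

psubF-∘-cong : ∀ {k} (ρ τ ρ' τ' : PSub) (A : Formula k) →
               (∀ s i → OccF s i A → psubT ρ (τ s i) ≡ psubT ρ' (τ' s i)) →
               psubF ρ (psubF τ A) ≡ psubF ρ' (psubF τ' A)
psubF-∘-cong ρ τ ρ' τ' A e =
  trans (psubF-∘ ρ τ A) (trans (psubF-cong A e) (sym (psubF-∘ ρ' τ' A)))

single-hit : ∀ s b u → single s b u s b ≡ u
single-hit act b u with b ≟ b
... | yes _ = refl
... | no ne = ⊥-elim (ne refl)
single-hit pas b u with b ≟ b
... | yes _ = refl
... | no ne = ⊥-elim (ne refl)
single-hit int b u with b ≟ b
... | yes _ = refl
... | no ne = ⊥-elim (ne refl)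

single-miss : ∀ {s b s' i} u → (s' , i) ≢ (s , b) → single s b u s' i ≡ par s' i
single-miss {act} {b} {act} {i} u ne with i ≟ b
... | yes refl = ⊥-elim (ne refl)
... | no _     = refl
single-miss {pas} {b} {pas} {i} u ne with i ≟ b
... | yes refl = ⊥-elim (ne refl)
... | no _     = refl
single-miss {int} {b} {int} {i} u ne with i ≟ b
... | yes refl = ⊥-elim (ne refl)
... | no _     = refl
single-miss {act} {s' = pas} u ne = refl
single-miss {act} {s' = int} u ne = refl
single-miss {pas} {s' = act} u ne = refl
single-miss {pas} {s' = int} u ne = refl
single-miss {int} {s' = act} u ne = refl
single-miss {int} {s' = pas} u ne = refl

psubF-single-self : ∀ s b (A : Formula 0) → psubF (single s b (par s b)) A ≡ A
psubF-single-self s b A = psubF-idᵒ _ A self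
  where
  self : ∀ s' i → OccF s' i A → single s b (par s b) s' i ≡ par s' i
  self s' i _ with (s' , i) ≟ₚ (s , b)
  ... | yes refl = single-hit s b (par s b)
  ... | no ne    = single-miss _ ne

psubT-par : ∀ ρ s i → psubT ρ (par s i) ≡ ρ s i
psubT-par ρ s i = emb-id (ρ s i)

psubT-single-∉ : ∀ {k} s b u (t : Term k) → ¬ OccT s b t → psubT (single s b u) t ≡ t
psubT-single-∉ s b u t b∉t =
  trans (psubT-cong t λ s' i o → single-miss {s} {b} u λ { refl → b∉t o }) (psubT-id t)

psubF-single-∉ : ∀ {k} s b u (A : Formula k) → ¬ OccF s b A → psubF (single s b u) A ≡ A
psubF-single-∉ s b u A b∉A = psubF-idᵒ _ A λ s' i o → single-miss {s} {b} u λ { refl → b∉A o }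

absT : ∀ {k} → Sort → ℕ → Term k → Term (suc k)
absT {k} s a (par s' i) with (s' , i) ≟ₚ (s , a)
... | yes _ = bv (fromℕ k)
... | no _  = par s' i
absT s a (bv x)  = bv (inject₁ x)
absT s a `0      = `0
absT s a (`s t)  = `s (absT s a t)
absT s a (â t u) = â (absT s a t) (absT s a u)
absT s a (m̂ t u) = m̂ (absT s a t) (absT s a u)

absF : ∀ {k} → Sort → ℕ → Formula k → Formula (suc k)
absF s a (t ≐ u)  = absT s a t ≐ absT s a u
absF s a (¬' A)   = ¬' (absF s a A)
absF s a (A ∧' B) = absF s a A ∧' absF s a B
absF s a (A ∨' B) = absF s a A ∨' absF s a B
absF s a (A ⊃' B) = absF s a A ⊃' absF s a B
absF s a (∀' A)   = ∀' (absF s a A)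
absF s a (∃' A)   = ∃' (absF s a A)

module _ (s : Sort) (a : ℕ) (u : Term 0) where

  -- absT binds the parameter as the outermost bound variable, fromℕ k
  Instantiating : ∀ {k} → (Fin (suc k) → Term k) → Set
  Instantiating {k} σ = σ (fromℕ k) ≡ emb u × (∀ x → σ (inject₁ x) ≡ bv x)

  liftσ-instantiating : ∀ {k} (σ : Fin (suc k) → Term k) → Instantiating σ → Instantiating (liftσ σ)
  liftσ-instantiating σ (top , rest) = trans (cong wkT top) (subT-emb _ u) , rest'
    where
    rest' : ∀ x → liftσ σ (inject₁ x) ≡ bv x
    rest' fz     = refl
    rest' (fs x) = cong wkT (rest x)

  subT-absT : ∀ {k} (σ : Fin (suc k) → Term k) → Instantiating σ → (t : Term k) →
              subT σ (absT s a t) ≡ psubT (single s a u) t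
  subT-absT σ g (par s' i) with (s' , i) ≟ₚ (s , a)
  ... | yes refl = trans (proj₁ g) (cong emb (sym (single-hit s a u)))
  ... | no ne    = cong emb (sym (single-miss u ne))
  subT-absT σ g (bv x)  = proj₂ g x
  subT-absT σ g `0      = refl
  subT-absT σ g (`s t)  = cong `s (subT-absT σ g t)
  subT-absT σ g (â t v) = cong₂ â (subT-absT σ g t) (subT-absT σ g v)
  subT-absT σ g (m̂ t v) = cong₂ m̂ (subT-absT σ g t) (subT-absT σ g v)

  subF-absF : ∀ {k} (σ : Fin (suc k) → Term k) → Instantiating σ → (A : Formula k) →
              subF σ (absF s a A) ≡ psubF (single s a u) A
  subF-absF σ g (t ≐ v)  = cong₂ _≐_ (subT-absT σ g t) (subT-absT σ g v)
  subF-absF σ g (¬' A)   = cong ¬' (subF-absF σ g A)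
  subF-absF σ g (A ∧' B) = cong₂ _∧'_ (subF-absF σ g A) (subF-absF σ g B)
  subF-absF σ g (A ∨' B) = cong₂ _∨'_ (subF-absF σ g A) (subF-absF σ g B)
  subF-absF σ g (A ⊃' B) = cong₂ _⊃'_ (subF-absF σ g A) (subF-absF σ g B)
  subF-absF σ g (∀' A)   = cong ∀' (subF-absF (liftσ σ) (liftσ-instantiating σ g) A)
  subF-absF σ g (∃' A)   = cong ∃' (subF-absF (liftσ σ) (liftσ-instantiating σ g) A)

  inst-absF : (A : Formula 0) → inst (absF s a A) u ≡ psubF (single s a u) A
  inst-absF = subF-absF _ (sym (emb-id u) , λ ())

absT-occ : ∀ {k} s a {s' j} (t : Term k) → OccT s' j (absT s a t) → OccT s' j t × (s' , j) ≢ (s , a)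
absT-occ s a (par s' i) o with (s' , i) ≟ₚ (s , a)
absT-occ s a (par s' i) () | yes _
absT-occ s a (par s' i) here | no ne = here , ne
absT-occ s a (bv x) ()
absT-occ s a `0 ()
absT-occ s a (`s t)  (s₁ o) = map₁ s₁ (absT-occ s a t o)
absT-occ s a (â t u) (â₁ o) = map₁ â₁ (absT-occ s a t o)
absT-occ s a (â t u) (â₂ o) = map₁ â₂ (absT-occ s a u o)
absT-occ s a (m̂ t u) (m̂₁ o) = map₁ m̂₁ (absT-occ s a t o)
absT-occ s a (m̂ t u) (m̂₂ o) = map₁ m̂₂ (absT-occ s a u o)

absF-occ : ∀ {k} s a {s' j} (A : Formula k) → OccF s' j (absF s a A) → OccF s' j A × (s' , j) ≢ (s , a)
absF-occ s a (t ≐ u)  (≐₁ o) = map₁ ≐₁ (absT-occ s a t o)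
absF-occ s a (t ≐ u)  (≐₂ o) = map₁ ≐₂ (absT-occ s a u o)
absF-occ s a (¬' A)   (¬₁ o) = map₁ ¬₁ (absF-occ s a A o)
absF-occ s a (A ∧' B) (∧₁ o) = map₁ ∧₁ (absF-occ s a A o)
absF-occ s a (A ∧' B) (∧₂ o) = map₁ ∧₂ (absF-occ s a B o)
absF-occ s a (A ∨' B) (∨₁ o) = map₁ ∨₁ (absF-occ s a A o)
absF-occ s a (A ∨' B) (∨₂ o) = map₁ ∨₂ (absF-occ s a B o)
absF-occ s a (A ⊃' B) (⊃₁ o) = map₁ ⊃₁ (absF-occ s a A o)
absF-occ s a (A ⊃' B) (⊃₂ o) = map₁ ⊃₂ (absF-occ s a B o)
absF-occ s a (∀' A)   (∀₁ o) = map₁ ∀₁ (absF-occ s a A o)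
absF-occ s a (∃' A)   (∃₁ o) = map₁ ∃₁ (absF-occ s a A o)

occ-emb⁻ : ∀ {k s i} (u : Term 0) → OccT s i (emb {k} u) → OccT s i u
occ-emb⁻ (par _ _) here   = here
occ-emb⁻ (bv ())
occ-emb⁻ `0 ()
occ-emb⁻ (`s u)  (s₁ o) = s₁ (occ-emb⁻ u o)
occ-emb⁻ (â t u) (â₁ o) = â₁ (occ-emb⁻ t o)
occ-emb⁻ (â t u) (â₂ o) = â₂ (occ-emb⁻ u o)
occ-emb⁻ (m̂ t u) (m̂₁ o) = m̂₁ (occ-emb⁻ t o)
occ-emb⁻ (m̂ t u) (m̂₂ o) = m̂₂ (occ-emb⁻ u o)

occ-emb⁺ : ∀ {k s i} (u : Term 0) → OccT s i u → OccT s i (emb {k} u)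
occ-emb⁺ (par _ _) here   = here
occ-emb⁺ (`s u)  (s₁ o) = s₁ (occ-emb⁺ u o)
occ-emb⁺ (â t u) (â₁ o) = â₁ (occ-emb⁺ t o)
occ-emb⁺ (â t u) (â₂ o) = â₂ (occ-emb⁺ u o)
occ-emb⁺ (m̂ t u) (m̂₁ o) = m̂₁ (occ-emb⁺ t o)
occ-emb⁺ (m̂ t u) (m̂₂ o) = m̂₂ (occ-emb⁺ u o)

act∉par-pas : ∀ {k i z} → ¬ OccT {k} act i (par pas z)
act∉par-pas ()

occ-par : ∀ {k s i s' j} → OccT {k} s i (par s' j) → (s' , j) ≡ (s , i)
occ-par here = refl

Origin : PSub → Sort → ℕ → (Sort → ℕ → Set) → Set
Origin ρ s i OccX = ∃₂ λ s' j → OccX s' j × OccT s i (ρ s' j)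

origin-map : ∀ {ρ s i} {P Q : Sort → ℕ → Set} → (∀ {s' j} → P s' j → Q s' j) →
             Origin ρ s i P → Origin ρ s i Q
origin-map f (s' , j , p , o) = s' , j , f p , o

occ-psubT⁻ : ∀ {k} ρ {s i} (t : Term k) → OccT s i (psubT ρ t) → Origin ρ s i (λ s' j → OccT s' j t)
occ-psubT⁻ ρ (par s' j) o   = s' , j , here , occ-emb⁻ (ρ s' j) o
occ-psubT⁻ ρ (bv x) ()
occ-psubT⁻ ρ `0 ()
occ-psubT⁻ ρ (`s t)  (s₁ o) = origin-map s₁ (occ-psubT⁻ ρ t o)
occ-psubT⁻ ρ (â t u) (â₁ o) = origin-map â₁ (occ-psubT⁻ ρ t o)
occ-psubT⁻ ρ (â t u) (â₂ o) = origin-map â₂ (occ-psubT⁻ ρ u o)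
occ-psubT⁻ ρ (m̂ t u) (m̂₁ o) = origin-map m̂₁ (occ-psubT⁻ ρ t o)
occ-psubT⁻ ρ (m̂ t u) (m̂₂ o) = origin-map m̂₂ (occ-psubT⁻ ρ u o)

occ-psubF⁻ : ∀ {k} ρ {s i} (A : Formula k) → OccF s i (psubF ρ A) → Origin ρ s i (λ s' j → OccF s' j A)
occ-psubF⁻ ρ (t ≐ u)  (≐₁ o) = origin-map ≐₁ (occ-psubT⁻ ρ t o)
occ-psubF⁻ ρ (t ≐ u)  (≐₂ o) = origin-map ≐₂ (occ-psubT⁻ ρ u o)
occ-psubF⁻ ρ (¬' A)   (¬₁ o) = origin-map ¬₁ (occ-psubF⁻ ρ A o)
occ-psubF⁻ ρ (A ∧' B) (∧₁ o) = origin-map ∧₁ (occ-psubF⁻ ρ A o)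
occ-psubF⁻ ρ (A ∧' B) (∧₂ o) = origin-map ∧₂ (occ-psubF⁻ ρ B o)
occ-psubF⁻ ρ (A ∨' B) (∨₁ o) = origin-map ∨₁ (occ-psubF⁻ ρ A o)
occ-psubF⁻ ρ (A ∨' B) (∨₂ o) = origin-map ∨₂ (occ-psubF⁻ ρ B o)
occ-psubF⁻ ρ (A ⊃' B) (⊃₁ o) = origin-map ⊃₁ (occ-psubF⁻ ρ A o)
occ-psubF⁻ ρ (A ⊃' B) (⊃₂ o) = origin-map ⊃₂ (occ-psubF⁻ ρ B o)
occ-psubF⁻ ρ (∀' A)   (∀₁ o) = origin-map ∀₁ (occ-psubF⁻ ρ A o)
occ-psubF⁻ ρ (∃' A)   (∃₁ o) = origin-map ∃₁ (occ-psubF⁻ ρ A o)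

occ-psubT⁺ : ∀ {k} ρ {s i s' j} (t : Term k) → OccT s' j t → OccT s i (ρ s' j) → OccT s i (psubT ρ t)
occ-psubT⁺ ρ (par _ _) here   o = occ-emb⁺ (ρ _ _) o
occ-psubT⁺ ρ (`s t)    (s₁ p) o = s₁ (occ-psubT⁺ ρ t p o)
occ-psubT⁺ ρ (â t u)   (â₁ p) o = â₁ (occ-psubT⁺ ρ t p o)
occ-psubT⁺ ρ (â t u)   (â₂ p) o = â₂ (occ-psubT⁺ ρ u p o)
occ-psubT⁺ ρ (m̂ t u)   (m̂₁ p) o = m̂₁ (occ-psubT⁺ ρ t p o)
occ-psubT⁺ ρ (m̂ t u)   (m̂₂ p) o = m̂₂ (occ-psubT⁺ ρ u p o)

occ-psubF⁺ : ∀ {k} ρ {s i s' j} (A : Formula k) → OccF s' j A → OccT s i (ρ s' j) → OccF s i (psubF ρ A)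
occ-psubF⁺ ρ (t ≐ u)  (≐₁ p) o = ≐₁ (occ-psubT⁺ ρ t p o)
occ-psubF⁺ ρ (t ≐ u)  (≐₂ p) o = ≐₂ (occ-psubT⁺ ρ u p o)
occ-psubF⁺ ρ (¬' A)   (¬₁ p) o = ¬₁ (occ-psubF⁺ ρ A p o)
occ-psubF⁺ ρ (A ∧' B) (∧₁ p) o = ∧₁ (occ-psubF⁺ ρ A p o)
occ-psubF⁺ ρ (A ∧' B) (∧₂ p) o = ∧₂ (occ-psubF⁺ ρ B p o)
occ-psubF⁺ ρ (A ∨' B) (∨₁ p) o = ∨₁ (occ-psubF⁺ ρ A p o)
occ-psubF⁺ ρ (A ∨' B) (∨₂ p) o = ∨₂ (occ-psubF⁺ ρ B p o)
occ-psubF⁺ ρ (A ⊃' B) (⊃₁ p) o = ⊃₁ (occ-psubF⁺ ρ A p o)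
occ-psubF⁺ ρ (A ⊃' B) (⊃₂ p) o = ⊃₂ (occ-psubF⁺ ρ B p o)
occ-psubF⁺ ρ (∀' A)   (∀₁ p) o = ∀₁ (occ-psubF⁺ ρ A p o)
occ-psubF⁺ ρ (∃' A)   (∃₁ p) o = ∃₁ (occ-psubF⁺ ρ A p o)

OccL : Sort → ℕ → List (Formula 0) → Set
OccL s i = Any (OccF s i)

occL-psub⁻ : ∀ ρ {s i} Γ → OccL s i (map (psubF ρ) Γ) → Origin ρ s i (λ s' j → OccL s' j Γ)
occL-psub⁻ ρ (A ∷ Γ) (here o)  = origin-map here (occ-psubF⁻ ρ A o)
occL-psub⁻ ρ (A ∷ Γ) (there o) = origin-map there (occL-psub⁻ ρ Γ o)

map-psubF-idᵒ : ∀ ρ Γ → (∀ s i → OccL s i Γ → ρ s i ≡ par s i) → map (psubF ρ) Γ ≡ Γ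
map-psubF-idᵒ ρ []      h = refl
map-psubF-idᵒ ρ (A ∷ Γ) h =
  cong₂ _∷_ (psubF-idᵒ ρ A λ s i → h s i ∘ here) (map-psubF-idᵒ ρ Γ λ s i → h s i ∘ there)

occ-single : ∀ {s b u s' j s'' i} → OccT s'' i (single s b u s' j) →
             OccT s'' i u ⊎ ((s' , j) ≡ (s'' , i) × (s' , j) ≢ (s , b))
occ-single {s} {b} {u} {s'} {j} o with (s' , j) ≟ₚ (s , b)
... | yes refl = inj₁ (subst (OccT _ _) (single-hit s b u) o)
... | no ne    = inj₂ (occ-par (subst (OccT _ _) (single-miss u ne) o) , ne)

map-psubF-single-∉ : ∀ s b u L → ¬ OccL s b L → map (psubF (single s b u)) L ≡ L
map-psubF-single-∉ s b u []      _   = refl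
map-psubF-single-∉ s b u (A ∷ L) b∉ =
  cong₂ _∷_ (psubF-single-∉ s b u A (b∉ ∘ here)) (map-psubF-single-∉ s b u L (b∉ ∘ there))

psubF-single-single : ∀ s b u w (A : Formula 0) →
  psubF (single s b u) (psubF (single s b w) A) ≡ psubF (single s b (psubT (single s b u) w)) A
psubF-single-single s b u w A = trans (psubF-∘ _ _ A) (psubF-cong A pointwise)
  where
  pointwise : ∀ s' j → OccF s' j A →
              psubT (single s b u) (single s b w s' j) ≡ single s b (psubT (single s b u) w) s' j
  pointwise s' j _ with (s' , j) ≟ₚ (s , b)
  ... | yes refl = trans (cong (psubT _) (single-hit s b w)) (sym (single-hit s b _))
  ... | no ne    = trans (cong (psubT _) (single-miss w ne))
                         (trans (cong emb (single-miss u ne)) (sym (single-miss _ ne)))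

psubF-single-via-act : ∀ τ b n (G : Formula 0) → (∀ i → ¬ OccF act i G) →
  (∀ s j → s ≢ act → τ s j ≡ par s j) →
  psubF τ (psubF (single pas b (par act n)) G) ≡ psubF (single pas b (τ act n)) G
psubF-single-via-act τ b n G act∉G τ-fixes = trans (psubF-∘ τ _ G) (psubF-cong G pointwise)
  where
  pointwise : ∀ s j → OccF s j G → psubT τ (single pas b (par act n) s j) ≡ single pas b (τ act n) s j
  pointwise s j o with (s , j) ≟ₚ (pas , b)
  ... | yes refl = trans (cong (psubT τ) (single-hit pas b _))
                         (trans (psubT-par τ act n) (sym (single-hit pas b _)))
  ... | no ne    = trans (cong (psubT τ) (single-miss _ ne))
                         (trans (psubT-par τ s j)
                                (trans (τ-fixes s j λ { refl → act∉G j o }) (sym (single-miss _ ne))))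

maxT : ∀ {k} → Term k → ℕ
maxT (par s i) = i
maxT (bv x)    = 0
maxT `0        = 0
maxT (`s t)    = maxT t
maxT (â t u)   = maxT t ⊔ maxT u
maxT (m̂ t u)   = maxT t ⊔ maxT u

maxF : ∀ {k} → Formula k → ℕ
maxF (t ≐ u)  = maxT t ⊔ maxT u
maxF (¬' A)   = maxF A
maxF (A ∧' B) = maxF A ⊔ maxF B
maxF (A ∨' B) = maxF A ⊔ maxF B
maxF (A ⊃' B) = maxF A ⊔ maxF B
maxF (∀' A)   = maxF A
maxF (∃' A)   = maxF A

maxL : List (Formula 0) → ℕ
maxL []      = 0
maxL (A ∷ L) = maxF A ⊔ maxL L

private
  ≤-⊔ˡ : ∀ {i} m n → i ≤ m → i ≤ m ⊔ n
  ≤-⊔ˡ m n p = ≤-trans p (m≤m⊔n m n)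

  ≤-⊔ʳ : ∀ {i} m n → i ≤ n → i ≤ m ⊔ n
  ≤-⊔ʳ m n p = ≤-trans p (m≤n⊔m m n)

occ⇒≤maxT : ∀ {k s i} (t : Term k) → OccT s i t → i ≤ maxT t
occ⇒≤maxT (par s i) here   = ≤-refl
occ⇒≤maxT (`s t)    (s₁ o) = occ⇒≤maxT t o
occ⇒≤maxT (â t u)   (â₁ o) = ≤-⊔ˡ (maxT t) (maxT u) (occ⇒≤maxT t o)
occ⇒≤maxT (â t u)   (â₂ o) = ≤-⊔ʳ (maxT t) (maxT u) (occ⇒≤maxT u o)
occ⇒≤maxT (m̂ t u)   (m̂₁ o) = ≤-⊔ˡ (maxT t) (maxT u) (occ⇒≤maxT t o)
occ⇒≤maxT (m̂ t u)   (m̂₂ o) = ≤-⊔ʳ (maxT t) (maxT u) (occ⇒≤maxT u o)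

occ⇒≤maxF : ∀ {k s i} (A : Formula k) → OccF s i A → i ≤ maxF A
occ⇒≤maxF (t ≐ u)  (≐₁ o) = ≤-⊔ˡ (maxT t) (maxT u) (occ⇒≤maxT t o)
occ⇒≤maxF (t ≐ u)  (≐₂ o) = ≤-⊔ʳ (maxT t) (maxT u) (occ⇒≤maxT u o)
occ⇒≤maxF (¬' A)   (¬₁ o) = occ⇒≤maxF A o
occ⇒≤maxF (A ∧' B) (∧₁ o) = ≤-⊔ˡ (maxF A) (maxF B) (occ⇒≤maxF A o)
occ⇒≤maxF (A ∧' B) (∧₂ o) = ≤-⊔ʳ (maxF A) (maxF B) (occ⇒≤maxF B o)
occ⇒≤maxF (A ∨' B) (∨₁ o) = ≤-⊔ˡ (maxF A) (maxF B) (occ⇒≤maxF A o)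
occ⇒≤maxF (A ∨' B) (∨₂ o) = ≤-⊔ʳ (maxF A) (maxF B) (occ⇒≤maxF B o)
occ⇒≤maxF (A ⊃' B) (⊃₁ o) = ≤-⊔ˡ (maxF A) (maxF B) (occ⇒≤maxF A o)
occ⇒≤maxF (A ⊃' B) (⊃₂ o) = ≤-⊔ʳ (maxF A) (maxF B) (occ⇒≤maxF B o)
occ⇒≤maxF (∀' A)   (∀₁ o) = occ⇒≤maxF A o
occ⇒≤maxF (∃' A)   (∃₁ o) = occ⇒≤maxF A o

occ⇒≤maxL : ∀ {s i} L → OccL s i L → i ≤ maxL L
occ⇒≤maxL (A ∷ L) (here o)  = ≤-⊔ˡ (maxF A) (maxL L) (occ⇒≤maxF A o)
occ⇒≤maxL (A ∷ L) (there o) = ≤-⊔ʳ (maxF A) (maxL L) (occ⇒≤maxL L o)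

fresh : List (Formula 0) → ℕ
fresh L = suc (maxL L)

fresh-∉ : ∀ {s} L → ¬ OccL s (fresh L) L
fresh-∉ L o = 1+n≰n (occ⇒≤maxL L o)

MovesOnly : PSub → List (Sort × ℕ) → List (Formula 0) → Set
MovesOnly σ Ps L = ∀ s i → OccL s i L → ¬ (s , i) ∈ Ps → σ s i ≡ par s i

fixPas : ℕ → PSub → PSub
fixPas z σ pas j with j ≟ z
... | yes _ = par pas z
... | no _  = σ pas j
fixPas z σ act j = σ act j
fixPas z σ int j = σ int j

fixPas-hit : ∀ z σ → fixPas z σ pas z ≡ par pas z
fixPas-hit z σ with z ≟ z
... | yes _ = refl
... | no ne = ⊥-elim (ne refl)

fixPas-miss : ∀ z σ s j → (s , j) ≢ (pas , z) → fixPas z σ s j ≡ σ s j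
fixPas-miss z σ pas j ne with j ≟ z
... | yes refl = ⊥-elim (ne refl)
... | no _     = refl
fixPas-miss z σ act j ne = refl
fixPas-miss z σ int j ne = refl

occL-rename⁻ : ∀ {s b z s' j} L → OccL s' j (map (psubF (single s b (par pas z))) L) →
               (s' , j) ≡ (pas , z) ⊎ (OccL s' j L × (s' , j) ≢ (s , b))
occL-rename⁻ {s} {b} {z} L o with occL-psub⁻ _ L o
... | _ , _ , oc , oin with occ-single {s} {b} {par pas z} oin
...   | inj₁ here          = inj₁ refl
...   | inj₂ (refl , ne)   = inj₂ (oc , ne)

rename-fix-instantiate : ∀ σ s b z (A : Formula 0) → ¬ OccF pas z A → ¬ OccF pas z (psubF σ A) →
  psubF (single pas z (σ s b)) (psubF (fixPas z σ) (psubF (single s b (par pas z)) A)) ≡ psubF σ A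
rename-fix-instantiate σ s b z A z∉A z∉σA =
  trans (cong (psubF ψ) (psubF-∘ (fixPas z σ) _ A)) (trans (psubF-∘ ψ _ A) (psubF-cong A pointwise))
  where
  open ≡-Reasoning
  ψ = single pas z (σ s b)
  pointwise : ∀ s' j → OccF s' j A →
              psubT ψ (psubT (fixPas z σ) (single s b (par pas z) s' j)) ≡ σ s' j
  pointwise s' j o with (s' , j) ≟ₚ (s , b)
  ... | yes refl = begin
    psubT ψ (psubT (fixPas z σ) (single s b (par pas z) s b))
      ≡⟨ cong (psubT ψ ∘ psubT (fixPas z σ)) (single-hit s b _) ⟩
    psubT ψ (emb (fixPas z σ pas z))
      ≡⟨ cong (psubT ψ ∘ emb) (fixPas-hit z σ) ⟩
    psubT ψ (par pas z)
      ≡⟨ psubT-par ψ pas z ⟩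
    ψ pas z
      ≡⟨ single-hit pas z (σ s b) ⟩
    σ s b ∎
  ... | no ne = begin
    psubT ψ (psubT (fixPas z σ) (single s b (par pas z) s' j))
      ≡⟨ cong (psubT ψ ∘ psubT (fixPas z σ)) (single-miss _ ne) ⟩
    psubT ψ (emb (fixPas z σ s' j))
      ≡⟨ cong (psubT ψ ∘ emb) (fixPas-miss z σ s' j λ { refl → z∉A o }) ⟩
    psubT ψ (emb (σ s' j))
      ≡⟨ cong (psubT ψ) (emb-id (σ s' j)) ⟩
    psubT ψ (σ s' j)
      ≡⟨ psubT-single-∉ pas z _ (σ s' j) (z∉σA ∘ occ-psubF⁺ σ A o) ⟩
    σ s' j ∎

map-rename-fix-instantiate : ∀ σ s b z L → ¬ OccL pas z L → ¬ OccL pas z (map (psubF σ) L) →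
  map (psubF (single pas z (σ s b))) (map (psubF (fixPas z σ)) (map (psubF (single s b (par pas z))) L))
    ≡ map (psubF σ) L
map-rename-fix-instantiate σ s b z []      _    _     = refl
map-rename-fix-instantiate σ s b z (A ∷ L) z∉AL z∉σAL =
  cong₂ _∷_ (rename-fix-instantiate σ s b z A (z∉AL ∘ here) (z∉σAL ∘ here))
            (map-rename-fix-instantiate σ s b z L (z∉AL ∘ there) (z∉σAL ∘ there))

⊤F : Formula 0
⊤F = `0 ≐ `0

⋀ : List (Formula 0) → Formula 0
⋀ []      = ⊤F
⋀ (A ∷ Γ) = A ∧' ⋀ Γ

⋁ : List (Formula 0) → Formula 0
⋁ []      = ¬' ⊤F
⋁ (A ∷ Δ) = A ∨' ⋁ Δ

psubF-⋀ : ∀ ρ Γ → psubF ρ (⋀ Γ) ≡ ⋀ (map (psubF ρ) Γ)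
psubF-⋀ ρ []      = refl
psubF-⋀ ρ (A ∷ Γ) = cong (psubF ρ A ∧'_) (psubF-⋀ ρ Γ)

psubF-⋁ : ∀ ρ Δ → psubF ρ (⋁ Δ) ≡ ⋁ (map (psubF ρ) Δ)
psubF-⋁ ρ []      = refl
psubF-⋁ ρ (A ∷ Δ) = cong (psubF ρ A ∨'_) (psubF-⋁ ρ Δ)

record Calculus : Set₁ where
  field
    Eig        : Sort → Set
    Derivable  : Seq → Set
    WellFormed : Seq → Set
    infer      : ∀ {ps S} → Rule Eig ps S → WellFormed S → All Derivable ps → Derivable S
    pas-eig    : Eig pas

-- Derived rules are carried out among sequents whose active parameters lie in
-- Allowed; wf says that this guarantees the side condition WellFormed of each rule.
module Admissible (𝒞 : Calculus) (Allowed : ℕ → Set)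
  (wf : ∀ {S} → (∀ i → OccSeq act i S → Allowed i) → Calculus.WellFormed 𝒞 S) where

  open Calculus 𝒞

  Within : Formula 0 → Set
  Within A = ∀ i → OccF act i A → Allowed i

  Withins : List (Formula 0) → Set
  Withins = All Within

  within-any : ∀ {i Γ} → Withins Γ → OccL act i Γ → Allowed i
  within-any (w ∷ _)  (here o)  = w _ o
  within-any (_ ∷ ws) (there o) = within-any ws o

  withins-¬act : ∀ L → (∀ {i} → ¬ OccL act i L) → Withins L
  withins-¬act []      _    = []
  withins-¬act (A ∷ L) act∉ = (λ i o → ⊥-elim (act∉ (here o))) ∷ withins-¬act L (act∉ ∘ there)

  wf-within : ∀ {Γ Δ} → Withins Γ → Withins Δ → WellFormed (Γ ⇒ Δ)
  wf-within wΓ wΔ = wf λ i → [ within-any wΓ , within-any wΔ ]′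

  infer₀ : ∀ {Γ Δ} → Rule Eig [] (Γ ⇒ Δ) → Withins Γ → Withins Δ → Derivable (Γ ⇒ Δ)
  infer₀ r wΓ wΔ = infer r (wf-within wΓ wΔ) []

  infer₁ : ∀ {P Γ Δ} → Rule Eig (P ∷ []) (Γ ⇒ Δ) → Withins Γ → Withins Δ →
           Derivable P → Derivable (Γ ⇒ Δ)
  infer₁ r wΓ wΔ d = infer r (wf-within wΓ wΔ) (d ∷ [])

  infer₂ : ∀ {P Q Γ Δ} → Rule Eig (P ∷ Q ∷ []) (Γ ⇒ Δ) → Withins Γ → Withins Δ →
           Derivable P → Derivable Q → Derivable (Γ ⇒ Δ)
  infer₂ r wΓ wΔ d e = infer r (wf-within wΓ wΔ) (d ∷ e ∷ [])

  cast : ∀ {Γ Γ' Δ Δ'} → Γ ≡ Γ' → Δ ≡ Δ' → Derivable (Γ ⇒ Δ) → Derivable (Γ' ⇒ Δ')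
  cast = subst₂ (λ Γ Δ → Derivable (Γ ⇒ Δ))

  hoistL : ∀ Θ Π {A Ψ Δ} → Withins Π → Withins Θ → Within A → Withins Ψ → Withins Δ →
           Derivable (Π ++ Θ ++ A ∷ Ψ ⇒ Δ) → Derivable (Π ++ A ∷ Θ ++ Ψ ⇒ Δ)
  hoistL []      Π wΠ wΘ wA wΨ wΔ d = d
  hoistL (B ∷ Θ) Π {A} {Ψ} wΠ (wB ∷ wΘ) wA wΨ wΔ d =
    infer₁ (eL {Γ = Π}) (++⁺ wΠ (wA ∷ wB ∷ ++⁺ wΘ wΨ)) wΔ
      (cast (++-assoc Π [ B ] (A ∷ Θ ++ Ψ)) refl
        (hoistL Θ (Π ∷ʳ B) (++⁺ wΠ (wB ∷ [])) wΘ wA wΨ wΔ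
          (cast (sym (++-assoc Π [ B ] (Θ ++ A ∷ Ψ))) refl d)))

  sinkL : ∀ Θ Π {A Ψ Δ} → Withins Π → Withins Θ → Within A → Withins Ψ → Withins Δ →
          Derivable (Π ++ A ∷ Θ ++ Ψ ⇒ Δ) → Derivable (Π ++ Θ ++ A ∷ Ψ ⇒ Δ)
  sinkL []      Π wΠ wΘ wA wΨ wΔ d = d
  sinkL (B ∷ Θ) Π {A} {Ψ} wΠ (wB ∷ wΘ) wA wΨ wΔ d =
    cast (++-assoc Π [ B ] (Θ ++ A ∷ Ψ)) refl
      (sinkL Θ (Π ∷ʳ B) (++⁺ wΠ (wB ∷ [])) wΘ wA wΨ wΔ
        (cast (sym (++-assoc Π [ B ] (A ∷ Θ ++ Ψ))) refl
          (infer₁ (eL {Γ = Π} {A = A}) (++⁺ wΠ (wB ∷ wA ∷ ++⁺ wΘ wΨ)) wΔ d)))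

  hoistR : ∀ Θ Π {Γ A Ψ} → Withins Γ → Withins Π → Withins Θ → Within A → Withins Ψ →
           Derivable (Γ ⇒ Π ++ Θ ++ A ∷ Ψ) → Derivable (Γ ⇒ Π ++ A ∷ Θ ++ Ψ)
  hoistR []      Π wΓ wΠ wΘ wA wΨ d = d
  hoistR (B ∷ Θ) Π {Γ} {A} {Ψ} wΓ wΠ (wB ∷ wΘ) wA wΨ d =
    infer₁ (eR {Δ = Π}) wΓ (++⁺ wΠ (wA ∷ wB ∷ ++⁺ wΘ wΨ))
      (cast refl (++-assoc Π [ B ] (A ∷ Θ ++ Ψ))
        (hoistR Θ (Π ∷ʳ B) wΓ (++⁺ wΠ (wB ∷ [])) wΘ wA wΨ
          (cast refl (sym (++-assoc Π [ B ] (Θ ++ A ∷ Ψ))) d)))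

  weakenL* : ∀ Θ {Γ Δ} → Withins Θ → Withins Γ → Withins Δ →
             Derivable (Γ ⇒ Δ) → Derivable (Θ ++ Γ ⇒ Δ)
  weakenL* []      wΘ        wΓ wΔ d = d
  weakenL* (B ∷ Θ) (wB ∷ wΘ) wΓ wΔ d = infer₁ (wL B) (wB ∷ ++⁺ wΘ wΓ) wΔ (weakenL* Θ wΘ wΓ wΔ d)

  weakenR* : ∀ Θ {Γ Δ} → Withins Θ → Withins Γ → Withins Δ →
             Derivable (Γ ⇒ Δ) → Derivable (Γ ⇒ Δ ++ Θ)
  weakenR* []      {Δ = Δ} wΘ wΓ wΔ d = cast refl (sym (++-identityʳ Δ)) d
  weakenR* (B ∷ Θ) {Δ = Δ} (wB ∷ wΘ) wΓ wΔ d =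
    cast refl (++-assoc Δ [ B ] Θ)
      (weakenR* Θ wΘ wΓ (++⁺ wΔ (wB ∷ [])) (infer₁ (wR B) wΓ (++⁺ wΔ (wB ∷ [])) d))

  within-⊤F : Within ⊤F
  within-⊤F i (≐₁ ())
  within-⊤F i (≐₂ ())

  within-∧ : ∀ {A B} → Within A → Within B → Within (A ∧' B)
  within-∧ wA wB i (∧₁ o) = wA i o
  within-∧ wA wB i (∧₂ o) = wB i o

  within-∨ : ∀ {A B} → Within A → Within B → Within (A ∨' B)
  within-∨ wA wB i (∨₁ o) = wA i o
  within-∨ wA wB i (∨₂ o) = wB i o

  within-⊃ : ∀ {A B} → Within A → Within B → Within (A ⊃' B)
  within-⊃ wA wB i (⊃₁ o) = wA i o
  within-⊃ wA wB i (⊃₂ o) = wB i o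

  within-⋀ : ∀ {Γ} → Withins Γ → Within (⋀ Γ)
  within-⋀ []        = within-⊤F
  within-⋀ (wA ∷ wΓ) = within-∧ wA (within-⋀ wΓ)

  within-⋁ : ∀ {Δ} → Withins Δ → Within (⋁ Δ)
  within-⋁ []        i (¬₁ o) = within-⊤F i o
  within-⋁ (wA ∷ wΔ) = within-∨ wA (within-⋁ wΔ)

  ⋀-left : ∀ Γ {Σ Δ} → Withins Γ → Withins Σ → Withins Δ →
           Derivable (Γ ++ Σ ⇒ Δ) → Derivable (⋀ Γ ∷ Σ ⇒ Δ)
  ⋀-left []      wΓ wΣ wΔ d = infer₁ (wL ⊤F) (within-⊤F ∷ wΣ) wΔ d
  ⋀-left (A ∷ Γ) {Σ} (wA ∷ wΓ) wΣ wΔ d =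
    infer₁ cL (wC ∷ wΣ) wΔ
      (infer₁ (∧L₂ A) (wC ∷ wC ∷ wΣ) wΔ
        (infer₁ (eL {Γ = []}) (w⋀ ∷ wC ∷ wΣ) wΔ
          (infer₁ (∧L₁ (⋀ Γ)) (wC ∷ w⋀ ∷ wΣ) wΔ
            (infer₁ (eL {Γ = []}) (wA ∷ w⋀ ∷ wΣ) wΔ
              (⋀-left Γ wΓ (wA ∷ wΣ) wΔ (sinkL Γ [] [] wΓ wA wΣ wΔ d))))))
    where
    w⋀ = within-⋀ wΓ
    wC = within-∧ wA w⋀

  ⋁-right : ∀ Δ {Γ Σ} → Withins Γ → Withins Σ → Withins Δ →
            Derivable (Γ ⇒ Σ ++ Δ) → Derivable (Γ ⇒ Σ ∷ʳ ⋁ Δ)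
  ⋁-right [] {Σ = Σ} wΓ wΣ wΔ d =
    infer₁ (wR (⋁ [])) wΓ (++⁺ wΣ (within-⋁ [] ∷ [])) (cast refl (++-identityʳ Σ) d)
  ⋁-right (A ∷ Δ) {Γ} {Σ} wΓ wΣ (wA ∷ wΔ) d =
    infer₁ (cR {Δ = Σ}) wΓ (++⁺ wΣ (wC ∷ []))
      (infer₁ (∨R₁ {Δ = Σ ∷ʳ C} (⋁ Δ)) wΓ (++⁺ (++⁺ wΣ (wC ∷ [])) (wC ∷ []))
        (cast refl (sym (++-assoc Σ [ C ] [ A ]))
          (infer₁ (eR {Δ = Σ} {Λ = []}) wΓ (++⁺ wΣ (wC ∷ wA ∷ []))
            (cast refl (++-assoc Σ [ A ] [ C ])
              (infer₁ (∨R₂ {Δ = Σ ∷ʳ A} A) wΓ (++⁺ (++⁺ wΣ (wA ∷ [])) (wC ∷ []))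
                (⋁-right Δ wΓ (++⁺ wΣ (wA ∷ [])) wΔ (cast refl (sym (++-assoc Σ [ A ] Δ)) d)))))))
    where
    C = A ∨' ⋁ Δ
    wC = within-∨ wA (within-⋁ wΔ)

  ⋀-right : ∀ Γ → Withins Γ → Derivable (Γ ⇒ [ ⋀ Γ ])
  ⋀-right []      _ = infer₀ (axiom (eq-refl `0)) [] (within-⊤F ∷ [])
  ⋀-right (A ∷ Γ) (wA ∷ wΓ) =
    infer₂ (∧R {Δ = []}) (wA ∷ wΓ) (within-⋀ (wA ∷ wΓ) ∷ [])
      (cast (cong (A ∷_) (++-identityʳ Γ)) refl
        (hoistL Γ [] [] wΓ wA [] (wA ∷ [])
          (weakenL* Γ wΓ (wA ∷ []) (wA ∷ []) (infer₀ (init A) (wA ∷ []) (wA ∷ [])))))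
      (infer₁ (wL A) (wA ∷ wΓ) (within-⋀ wΓ ∷ []) (⋀-right Γ wΓ))

  ⋁-left : ∀ Δ → Withins Δ → Derivable ([ ⋁ Δ ] ⇒ Δ)
  ⋁-left []      _ =
    infer₁ (¬L {Δ = []}) (within-⋁ [] ∷ []) [] (infer₀ (axiom (eq-refl `0)) [] (within-⊤F ∷ []))
  ⋁-left (A ∷ Δ) (wA ∷ wΔ) =
    infer₂ ∨L (within-⋁ (wA ∷ wΔ) ∷ []) (wA ∷ wΔ)
      (weakenR* Δ wΔ (wA ∷ []) (wA ∷ []) (infer₀ (init A) (wA ∷ []) (wA ∷ [])))
      (cast refl (cong (A ∷_) (++-identityʳ Δ))
        (hoistR Δ [] (w⋁ ∷ []) [] wΔ wA []
          (infer₁ (wR A) (w⋁ ∷ []) (++⁺ wΔ (wA ∷ [])) (⋁-left Δ wΔ))))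
    where
    w⋁ = within-⋁ wΔ

  pack : ∀ {Γ Δ} → Withins Γ → Withins Δ → Derivable (Γ ⇒ Δ) → Derivable ([] ⇒ [ ⋀ Γ ⊃' ⋁ Δ ])
  pack {Γ} wΓ wΔ d =
    infer₁ (⊃R {Δ = []}) [] (within-⊃ (within-⋀ wΓ) (within-⋁ wΔ) ∷ [])
      (⋁-right _ (within-⋀ wΓ ∷ []) [] wΔ (⋀-left Γ wΓ [] wΔ (cast (sym (++-identityʳ Γ)) refl d)))

  unpack : ∀ {Γ Δ} → Withins Γ → Withins Δ → Derivable ([] ⇒ [ ⋀ Γ ⊃' ⋁ Δ ]) → Derivable (Γ ⇒ Δ)
  unpack {Γ} {Δ} wΓ wΔ d =
    cast (++-identityʳ Γ) refl
      (infer₂ (cut {Γ = []} {Δ = []} (⋀ Γ ⊃' ⋁ Δ)) (++⁺ wΓ []) wΔ d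
        (infer₂ (⊃L {Δ = []} {Π = []}) (within-⊃ (within-⋀ wΓ) (within-⋁ wΔ) ∷ ++⁺ wΓ []) wΔ
          (⋀-right Γ wΓ) (⋁-left Δ wΔ)))

  ImageWithin : PSub → List (Formula 0) → Set
  ImageWithin ρ L = ∀ s i → OccL s i L → ∀ j → OccT act j (ρ s i) → Allowed j

  withins-psub : ∀ ρ L → ImageWithin ρ L → Withins (map (psubF ρ) L)
  withins-psub ρ []      image = []
  withins-psub ρ (A ∷ L) image = within ∷ withins-psub ρ L λ s i → image s i ∘ there
    where
    within : Within (psubF ρ A)
    within j o with occ-psubF⁻ ρ A o
    ... | s , i , oc , oin = image s i (here oc) j oin

  single-admissible : ∀ s b u → Eig s → ∀ {Γ Δ} → Withins Γ → Withins Δ →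
    let ψ = psubF (single s b u) in
    Withins (map ψ Γ) → Withins (map ψ Δ) → Derivable (Γ ⇒ Δ) → Derivable (map ψ Γ ⇒ map ψ Δ)
  single-admissible s b u eig {Γ} {Δ} wΓ wΔ wψΓ wψΔ d =
    unpack wψΓ wψΔ
      (cast refl (cong [_] F[u]≡ψP)
        (infer₂ (cut {Γ = []} {Δ = []} {Π = []} (∀' F)) [] (wF[u] ∷ [])
          (infer₁ (∀R {Δ = []} s b eig b∉∀F) [] (w∀F ∷ [])
            (cast refl (cong [_] (sym F[b]≡P)) (pack wΓ wΔ d)))
          (infer₁ (∀L u) (w∀F ∷ []) (wF[u] ∷ []) (infer₀ (init _) (wF[u] ∷ []) (wF[u] ∷ [])))))
    where
    ψ = psubF (single s b u)
    P = ⋀ Γ ⊃' ⋁ Δ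
    F = absF s b P
    wP : Within P
    wP = within-⊃ (within-⋀ wΓ) (within-⋁ wΔ)
    w∀F : Within (∀' F)
    w∀F i (∀₁ o) = wP i (proj₁ (absF-occ s b P o))
    b∉∀F : ¬ OccSeq s b ([] ⇒ [ ∀' F ])
    b∉∀F (inj₂ (here (∀₁ o))) = proj₂ (absF-occ s b P o) refl
    F[b]≡P : inst F (par s b) ≡ P
    F[b]≡P = trans (inst-absF s b (par s b) P) (psubF-single-self s b P)
    F[u]≡ψP : inst F u ≡ ⋀ (map ψ Γ) ⊃' ⋁ (map ψ Δ)
    F[u]≡ψP = trans (inst-absF s b u P) (cong₂ _⊃'_ (psubF-⋀ _ Γ) (psubF-⋁ _ Δ))
    wF[u] : Within (inst F u)
    wF[u] = subst Within (sym F[u]≡ψP) (within-⊃ (within-⋀ wψΓ) (within-⋁ wψΔ))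

  withins-rename : ∀ s b z L → Withins L → Withins (map (psubF (single s b (par pas z))) L)
  withins-rename s b z L wAll = withins-psub _ L image
    where
    image : ImageWithin (single s b (par pas z)) L
    image s' j oc i o with occ-single {s} {b} {par pas z} o
    ... | inj₂ (refl , _) = within-any wAll oc

  -- σ = [z ↦ σ (s , b)] ∘ (σ fixing z) ∘ [(s , b) ↦ z] for z fresh, and the middle factor
  -- moves only the remaining parameters Ps
  psub-admissible : ∀ Ps → All (Eig ∘ proj₁) Ps → ∀ Γ Δ σ →
    MovesOnly σ Ps (Γ ++ Δ) → ImageWithin σ (Γ ++ Δ) → Withins Γ → Withins Δ →
    Derivable (Γ ⇒ Δ) → Derivable (map (psubF σ) Γ ⇒ map (psubF σ) Δ)
  psub-admissible [] _ Γ Δ σ moves _ _ _ d =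
    cast (sym (map-psubF-idᵒ σ Γ λ s i o → moves s i (++⁺ˡ o) λ ()))
         (sym (map-psubF-idᵒ σ Δ λ s i o → moves s i (++⁺ʳ Γ o) λ ())) d
  psub-admissible ((s , b) ∷ Ps) (eig ∷ eigs) Γ Δ σ moves image wΓ wΔ d =
    cast eqΓ eqΔ
      (single-admissible pas z (σ s b) pas-eig wσ'Γ₁ wσ'Δ₁ wσΓ wσΔ
        (psub-admissible Ps eigs Γ₁ Δ₁ σ' moves' image' wΓ₁ wΔ₁
          (single-admissible s b (par pas z) eig wΓ wΔ wΓ₁ wΔ₁ d)))
    where
    σ̂ = psubF σ
    z = fresh (Γ ++ Δ ++ map σ̂ Γ ++ map σ̂ Δ)
    z∉ : ¬ OccL pas z (Γ ++ Δ ++ map σ̂ Γ ++ map σ̂ Δ)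
    z∉ = fresh-∉ (Γ ++ Δ ++ map σ̂ Γ ++ map σ̂ Δ)
    rename = psubF (single s b (par pas z))
    Γ₁ = map rename Γ
    Δ₁ = map rename Δ
    σ' = fixPas z σ

    classify : ∀ {s' j} → OccL s' j (Γ₁ ++ Δ₁) →
               (s' , j) ≡ (pas , z) ⊎ (OccL s' j (Γ ++ Δ) × (s' , j) ≢ (s , b))
    classify o = occL-rename⁻ (Γ ++ Δ) (subst (OccL _ _) (sym (map-++ rename Γ Δ)) o)

    σ'≡σ : ∀ {s' j} → OccL s' j (Γ ++ Δ) → σ' s' j ≡ σ s' j
    σ'≡σ o = fixPas-miss z σ _ _ λ { refl → z∉ (subst (OccL pas z) (++-assoc Γ Δ _) (++⁺ˡ o)) }

    moves' : MovesOnly σ' Ps (Γ₁ ++ Δ₁)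
    moves' s' j o ∉Ps with classify o
    ... | inj₁ refl      = fixPas-hit z σ
    ... | inj₂ (oc , ne) = trans (σ'≡σ oc) (moves s' j oc λ { (here eq) → ne eq ; (there m) → ∉Ps m })

    image' : ImageWithin σ' (Γ₁ ++ Δ₁)
    image' s' j o i oi with classify o
    ... | inj₁ refl     = ⊥-elim (act∉par-pas (subst (OccT act i) (fixPas-hit z σ) oi))
    ... | inj₂ (oc , _) = image s' j oc i (subst (OccT act i) (σ'≡σ oc) oi)

    wΓ₁ = withins-rename s b z Γ wΓ
    wΔ₁ = withins-rename s b z Δ wΔ
    wσ'Γ₁ = withins-psub σ' Γ₁ λ s' j → image' s' j ∘ ++⁺ˡ
    wσ'Δ₁ = withins-psub σ' Δ₁ λ s' j → image' s' j ∘ ++⁺ʳ Γ₁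
    eqΓ = map-rename-fix-instantiate σ s b z Γ (z∉ ∘ ++⁺ˡ) (z∉ ∘ ++⁺ʳ Γ ∘ ++⁺ʳ Δ ∘ ++⁺ˡ)
    eqΔ = map-rename-fix-instantiate σ s b z Δ (z∉ ∘ ++⁺ʳ Γ ∘ ++⁺ˡ)
            (z∉ ∘ ++⁺ʳ Γ ∘ ++⁺ʳ Δ ∘ ++⁺ʳ (map σ̂ Γ))
    wσΓ = subst Withins (sym eqΓ) (withins-psub σ Γ λ s' j → image s' j ∘ ++⁺ˡ)
    wσΔ = subst Withins (sym eqΔ) (withins-psub σ Δ λ s' j → image s' j ∘ ++⁺ʳ Γ)

Rule-map : ∀ {E E' : Sort → Set} → (∀ {s} → E s → E' s) → ∀ {ps S} → Rule E ps S → Rule E' ps S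
Rule-map f (init A)       = init A
Rule-map f (axiom ax)     = axiom ax
Rule-map f (wL A)         = wL A
Rule-map f (wR A)         = wR A
Rule-map f cL             = cL
Rule-map f cR             = cR
Rule-map f eL             = eL
Rule-map f eR             = eR
Rule-map f (cut A)        = cut A
Rule-map f ¬L             = ¬L
Rule-map f ¬R             = ¬R
Rule-map f (∧L₁ B)        = ∧L₁ B
Rule-map f (∧L₂ A)        = ∧L₂ A
Rule-map f ∧R             = ∧R
Rule-map f ∨L             = ∨L
Rule-map f (∨R₁ B)        = ∨R₁ B
Rule-map f (∨R₂ A)        = ∨R₂ A
Rule-map f ⊃L             = ⊃L
Rule-map f ⊃R             = ⊃R
Rule-map f (∀L t)         = ∀L t
Rule-map f (∀R s a e b∉)  = ∀R s a (f e) b∉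
Rule-map f (∃L s a e b∉)  = ∃L s a (f e) b∉
Rule-map f (∃R t)         = ∃R t

PA : Calculus
PA = record
  { Eig = AnySort ; Derivable = PAProof ; WellFormed = λ _ → ⊤
  ; infer = λ r _ → rule r ; pas-eig = tt }

module PA = Admissible PA (λ _ → ⊤) (λ _ → tt)

withins-PA : ∀ Γ → PA.Withins Γ
withins-PA = All.universal λ _ _ _ → tt

lookupInt-∉ : ∀ L i → All (λ p → i ≢ proj₁ p) L → lookupInt L i ≡ par int i
lookupInt-∉ []            i []         = refl
lookupInt-∉ ((m , a) ∷ L) i (ne ∷ nes) with i ≟ m
... | yes e = ⊥-elim (ne e)
... | no _  = lookupInt-∉ L i nes

indInstance : ℕ → Term 0 → List (ℕ × Term 0) → PSub
indInstance x t L pas j with j ≟ x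
... | yes _ = t
... | no _  = par pas j
indInstance x t L act j = par act j
indInstance x t L int j = lookupInt L j

indInstance-hit : ∀ x t L → indInstance x t L pas x ≡ t
indInstance-hit x t L with x ≟ x
... | yes _ = refl
... | no ne = ⊥-elim (ne refl)

indInstance-miss : ∀ x t L j → j ≢ x → indInstance x t L pas j ≡ par pas j
indInstance-miss x t L j ne with j ≟ x
... | yes e = ⊥-elim (ne e)
... | no _  = refl

pa-schematic-ind : ∀ (F : Formula 0) n L t Γ Δ → ¬ OccSeq act n (Γ ⇒ Δ) →
  All (λ p → ¬ OccSeq int (proj₁ p) (Γ ⇒ Δ)) L →
  PAProof (F ∷ Γ ⇒ Δ ∷ʳ psubF (single act n (`s (par act n))) F) →
  PAProof (psubF (indSub n `0 L) F ∷ Γ ⇒ Δ ∷ʳ psubF (indSub n t L) F)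
pa-schematic-ind F n L t Γ Δ n∉ L∉ d =
  PA.cast antecedent≡ succedent≡
    (PA.psub-admissible Ps (All.universal (λ _ → tt) Ps) Γ' Δ' σ moves (λ _ _ _ _ _ → tt)
      (withins-PA Γ') (withins-PA Δ') (ind F act n (par pas x) Γ Δ n∉ d))
  where
  x = fresh (F ∷ Γ ++ Δ)
  σ = indInstance x t L
  key : ℕ × Term 0 → Sort × ℕ
  key (m , _) = int , m
  Ps = (pas , x) ∷ map key L
  Γ' = psubF (single act n `0) F ∷ Γ
  Δ' = Δ ∷ʳ psubF (single act n (par pas x)) F

  moves : MovesOnly σ Ps (Γ' ++ Δ')
  moves act i _ _   = refl
  moves pas i _ ∉Ps = indInstance-miss x t L i λ { refl → ∉Ps (here refl) }
  moves int i _ ∉Ps = lookupInt-∉ L i (All.tabulate λ p∈L → λ { refl → ∉Ps (there (∈-map⁺ key p∈L)) })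

  fixes : ∀ s i → OccSeq s i (Γ ⇒ Δ) → σ s i ≡ par s i
  fixes act i o = refl
  fixes pas i o = indInstance-miss x t L i λ { refl → fresh-∉ (F ∷ Γ ++ Δ) (there ([ ++⁺ˡ , ++⁺ʳ Γ ]′ o)) }
  fixes int i o = lookupInt-∉ L i (All.map (λ i∉ → λ { refl → i∉ o }) L∉)

  σ∘single : ∀ v v' → psubT σ v ≡ v' → psubF σ (psubF (single act n v) F) ≡ psubF (indSub n v' L) F
  σ∘single v v' σv≡v' = trans (psubF-∘ σ _ F) (psubF-cong F pointwise)
    where
    pointwise : ∀ s i → OccF s i F → psubT σ (single act n v s i) ≡ indSub n v' L s i
    pointwise act i o with i ≟ n
    ... | yes _ = σv≡v'
    ... | no _  = refl
    pointwise pas i o = cong emb (indInstance-miss x t L i λ { refl → fresh-∉ (F ∷ Γ ++ Δ) (here o) })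
    pointwise int i o = emb-id (lookupInt L i)

  antecedent≡ : map (psubF σ) Γ' ≡ psubF (indSub n `0 L) F ∷ Γ
  antecedent≡ = cong₂ _∷_ (σ∘single `0 `0 refl) (map-psubF-idᵒ σ Γ λ s i → fixes s i ∘ inj₁)

  succedent≡ : map (psubF σ) Δ' ≡ Δ ∷ʳ psubF (indSub n t L) F
  succedent≡ =
    trans (map-++ (psubF σ) Δ _)
          (cong₂ _∷ʳ_ (map-psubF-idᵒ σ Δ λ s i → fixes s i ∘ inj₂)
                      (σ∘single (par pas x) t (trans (psubT-par σ pas x) (indInstance-hit x t L))))

mvlkie⇒pa : ∀ {S} → MVLKIE-EFree S → PAProof S
mvlkie⇒pa* : ∀ {ps} → All MVLKIE-EFree ps → All PAProof ps
mvlkie⇒pa (rule r _ ds)                 = rule (Rule-map _ r) (mvlkie⇒pa* ds)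
mvlkie⇒pa (ind F n L t Γ Δ n∉ L∉ _ d) = pa-schematic-ind F n L t Γ Δ n∉ L∉ (mvlkie⇒pa d)
mvlkie⇒pa* []       = []
mvlkie⇒pa* (d ∷ ds) = mvlkie⇒pa d ∷ mvlkie⇒pa* ds

sortCode : Sort → ℕ
sortCode act = 0
sortCode pas = 1
sortCode int = 2

encode : Sort → ℕ → ℕ
encode s zero    = sortCode s
encode s (suc i) = suc (suc (suc (encode s i)))

decode : ℕ → Sort × ℕ
decode zero                   = act , 0
decode (suc zero)             = pas , 0
decode (suc (suc zero))       = int , 0
decode (suc (suc (suc k)))    = map₂ suc (decode k)

decode-encode : ∀ s i → decode (encode s i) ≡ (s , i)
decode-encode act zero    = refl
decode-encode pas zero    = refl
decode-encode int zero    = refl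
decode-encode s   (suc i) = cong (map₂ suc) (decode-encode s i)

encode-injective : ∀ {s i s' j} → encode s i ≡ encode s' j → (s , i) ≡ (s' , j)
encode-injective {s} {i} {s'} {j} e =
  trans (sym (decode-encode s i)) (trans (cong decode e) (decode-encode s' j))

passive : PSub
passive s i = par pas (encode s i)

unpassive : PSub
unpassive pas j = par (proj₁ (decode j)) (proj₂ (decode j))
unpassive act j = par act j
unpassive int j = par int j

passiveF : Formula 0 → Formula 0
passiveF = psubF passive

passiveL : List (Formula 0) → List (Formula 0)
passiveL = map passiveF

psubSeq : PSub → Seq → Seq
psubSeq ρ (Γ ⇒ Δ) = map (psubF ρ) Γ ⇒ map (psubF ρ) Δ

passiveL-∷ʳ : ∀ Δ A → passiveL (Δ ∷ʳ A) ≡ passiveL Δ ∷ʳ passiveF A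
passiveL-∷ʳ Δ A = map-++ passiveF Δ [ A ]

act∉passiveF : ∀ {i} A → ¬ OccF act i (passiveF A)
act∉passiveF A o with occ-psubF⁻ passive A o
... | _ , _ , _ , ()

act∉passiveL : ∀ {i} Γ → ¬ OccL act i (passiveL Γ)
act∉passiveL (A ∷ Γ) (here o)  = act∉passiveF A o
act∉passiveL (A ∷ Γ) (there o) = act∉passiveL Γ o

occ-passiveL⁻ : ∀ {s a} Γ → OccL pas (encode s a) (passiveL Γ) → OccL s a Γ
occ-passiveL⁻ {s} {a} Γ o with occL-psub⁻ passive Γ o
... | s' , j , oc , oin with encode-injective {s'} {j} {s} {a} (cong proj₂ (occ-par oin))
...   | refl = oc

occSeq-passive⁻ : ∀ {s a} Γ Δ → OccSeq pas (encode s a) (passiveL Γ ⇒ passiveL Δ) → OccSeq s a (Γ ⇒ Δ)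
occSeq-passive⁻ Γ Δ = ⊎-map (occ-passiveL⁻ Γ) (occ-passiveL⁻ Δ)

unpassive-passive : ∀ (A : Formula 0) → psubF unpassive (passiveF A) ≡ A
unpassive-passive A =
  trans (psubF-∘ unpassive passive A)
        (psubF-idᵒ _ A λ s i _ → cong (λ p → emb (par (proj₁ p) (proj₂ p))) (decode-encode s i))

passiveF-single : ∀ s a w (A : Formula 0) →
  passiveF (psubF (single s a w) A) ≡ psubF (single pas (encode s a) (psubT passive w)) (passiveF A)
passiveF-single s a w A = psubF-∘-cong passive (single s a w) _ passive A pointwise
  where
  pointwise : ∀ s' j → OccF s' j A →
              psubT passive (single s a w s' j) ≡ psubT (single pas (encode s a) (psubT passive w)) (passive s' j)
  pointwise s' j _ with (s' , j) ≟ₚ (s , a)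
  ... | yes refl = begin
    psubT passive (single s a w s a)          ≡⟨ cong (psubT passive) (single-hit s a w) ⟩
    psubT passive w                            ≡⟨ sym (single-hit pas (encode s a) _) ⟩
    single pas (encode s a) (psubT passive w) pas (encode s a) ≡⟨ sym (emb-id _) ⟩
    emb (single pas (encode s a) (psubT passive w) pas (encode s a)) ∎
    where open ≡-Reasoning
  ... | no ne = trans (cong (psubT passive) (single-miss w ne))
                      (sym (cong emb (single-miss {pas} {encode s a} _ λ e → ne (encode-injective (cong proj₂ e)))))

AxPA-psub : ∀ ρ {S} → AxPA S → AxPA (psubSeq ρ S)
AxPA-psub ρ (eq-refl t)           = eq-refl _
AxPA-psub ρ (eq-s t u)            = eq-s _ _
AxPA-psub ρ (eq-â t₁ u₁ t₂ u₂)    = eq-â _ _ _ _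
AxPA-psub ρ (eq-m̂ t₁ u₁ t₂ u₂)    = eq-m̂ _ _ _ _
AxPA-psub ρ (eq-pred t₁ u₁ t₂ u₂) = eq-pred _ _ _ _
AxPA-psub ρ (s≢0 t)               = s≢0 _
AxPA-psub ρ (s-inj t u)           = s-inj _ _
AxPA-psub ρ (â-0 b)               = â-0 _
AxPA-psub ρ (â-s t b)             = â-s _ _
AxPA-psub ρ (m̂-0 b)               = m̂-0 _
AxPA-psub ρ (m̂-s t b)             = m̂-s _ _

Rule-cast : ∀ {E ps ps' S S'} → ps' ≡ ps → S' ≡ S → Rule E ps S → Rule E ps' S'
Rule-cast refl refl r = r

Rule-passive : ∀ {ps S} → Rule AnySort ps S → Rule Passive (map (psubSeq passive) ps) (psubSeq passive S)
Rule-passive (init A)   = init (passiveF A)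
Rule-passive (axiom ax) = axiom (AxPA-psub passive ax)
Rule-passive (wL A)     = wL (passiveF A)
Rule-passive (wR {Γ} {Δ} A) = Rule-cast refl (cong (passiveL Γ ⇒_) (passiveL-∷ʳ Δ A)) (wR (passiveF A))
Rule-passive cL         = cL
Rule-passive (cR {Γ} {Δ} {A}) =
  Rule-cast (cong (λ X → (passiveL Γ ⇒ X) ∷ [])
                  (trans (passiveL-∷ʳ (Δ ∷ʳ A) A) (cong (_∷ʳ passiveF A) (passiveL-∷ʳ Δ A))))
            (cong (passiveL Γ ⇒_) (passiveL-∷ʳ Δ A)) cR
Rule-passive (eL {Γ} {Π} {Δ} {A} {B}) =
  Rule-cast (cong (λ X → (X ⇒ passiveL Δ) ∷ []) (map-++ passiveF Γ (A ∷ B ∷ Π)))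
            (cong (_⇒ passiveL Δ) (map-++ passiveF Γ (B ∷ A ∷ Π))) eL
Rule-passive (eR {Γ} {Δ} {Λ} {A} {B}) =
  Rule-cast (cong (λ X → (passiveL Γ ⇒ X) ∷ []) (map-++ passiveF Δ (A ∷ B ∷ Λ)))
            (cong (passiveL Γ ⇒_) (map-++ passiveF Δ (B ∷ A ∷ Λ))) eR
Rule-passive (cut {Γ} {Δ} {Π} {Λ} A) =
  Rule-cast (cong (λ X → (passiveL Γ ⇒ X) ∷ _) (passiveL-∷ʳ Δ A))
            (cong₂ _⇒_ (map-++ passiveF Γ Π) (map-++ passiveF Δ Λ)) (cut (passiveF A))
Rule-passive (¬L {Γ} {Δ} {A}) =
  Rule-cast (cong (λ X → (passiveL Γ ⇒ X) ∷ []) (passiveL-∷ʳ Δ A)) refl ¬L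
Rule-passive (¬R {Γ} {Δ} {A}) =
  Rule-cast refl (cong (passiveL Γ ⇒_) (passiveL-∷ʳ Δ (¬' A))) ¬R
Rule-passive (∧L₁ B) = ∧L₁ (passiveF B)
Rule-passive (∧L₂ A) = ∧L₂ (passiveF A)
Rule-passive (∧R {Γ} {Δ} {A} {B}) =
  Rule-cast (cong₂ (λ X Y → (passiveL Γ ⇒ X) ∷ (passiveL Γ ⇒ Y) ∷ []) (passiveL-∷ʳ Δ A) (passiveL-∷ʳ Δ B))
            (cong (passiveL Γ ⇒_) (passiveL-∷ʳ Δ (A ∧' B))) ∧R
Rule-passive ∨L = ∨L
Rule-passive (∨R₁ {Γ} {Δ} {A} B) =
  Rule-cast (cong (λ X → (passiveL Γ ⇒ X) ∷ []) (passiveL-∷ʳ Δ A))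
            (cong (passiveL Γ ⇒_) (passiveL-∷ʳ Δ (A ∨' B))) (∨R₁ (passiveF B))
Rule-passive (∨R₂ {Γ} {Δ} {B} A) =
  Rule-cast (cong (λ X → (passiveL Γ ⇒ X) ∷ []) (passiveL-∷ʳ Δ B))
            (cong (passiveL Γ ⇒_) (passiveL-∷ʳ Δ (A ∨' B))) (∨R₂ (passiveF A))
Rule-passive (⊃L {Γ} {Δ} {Π} {Λ} {A} {B}) =
  Rule-cast (cong (λ X → (passiveL Γ ⇒ X) ∷ _) (passiveL-∷ʳ Δ A))
            (cong₂ _⇒_ (cong (passiveF (A ⊃' B) ∷_) (map-++ passiveF Γ Π)) (map-++ passiveF Δ Λ)) ⊃L
Rule-passive (⊃R {Γ} {Δ} {A} {B}) =
  Rule-cast (cong (λ X → (passiveF A ∷ passiveL Γ ⇒ X) ∷ []) (passiveL-∷ʳ Δ B))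
            (cong (passiveL Γ ⇒_) (passiveL-∷ʳ Δ (A ⊃' B))) ⊃R
Rule-passive (∀L {Γ} {Δ} {F} t) =
  Rule-cast (cong (λ X → (X ∷ passiveL Γ ⇒ passiveL Δ) ∷ []) (psubF-inst passive F t)) refl (∀L (psubT passive t))
Rule-passive (∃R {Γ} {Δ} {F} t) =
  Rule-cast (cong (λ X → (passiveL Γ ⇒ X) ∷ [])
                  (trans (passiveL-∷ʳ Δ (inst F t)) (cong (passiveL Δ ∷ʳ_) (psubF-inst passive F t))))
            (cong (passiveL Γ ⇒_) (passiveL-∷ʳ Δ (∃' F))) (∃R (psubT passive t))
Rule-passive (∀R {Γ} {Δ} {F} s a _ a∉) =
  Rule-cast (cong (λ X → (passiveL Γ ⇒ X) ∷ [])
                  (trans (passiveL-∷ʳ Δ (inst F (par s a)))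
                         (cong (passiveL Δ ∷ʳ_) (psubF-inst passive F (par s a)))))
            (cong (passiveL Γ ⇒_) (passiveL-∷ʳ Δ (∀' F)))
            (∀R pas (encode s a) refl
              (a∉ ∘ occSeq-passive⁻ Γ (Δ ∷ʳ ∀' F)
                  ∘ subst (λ Y → OccSeq _ _ (passiveL Γ ⇒ Y)) (sym (passiveL-∷ʳ Δ (∀' F)))))
Rule-passive (∃L {Γ} {Δ} {F} s a _ a∉) =
  Rule-cast (cong (λ X → (X ∷ passiveL Γ ⇒ passiveL Δ) ∷ []) (psubF-inst passive F (par s a))) refl
            (∃L pas (encode s a) refl (a∉ ∘ occSeq-passive⁻ (∃' F ∷ Γ) Δ))

MV : Calculus
MV = record
  { Eig = Passive ; Derivable = MVLKIE-EFree ; WellFormed = OneActive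
  ; infer = rule ; pas-eig = refl }

oneActive-passive : ∀ S → OneActive (psubSeq passive S)
oneActive-passive (Γ ⇒ Δ) i j o _ = ⊥-elim ([ act∉passiveL Γ , act∉passiveL Δ ]′ o)

module OnlyZero = Admissible MV (_≡ 0) (λ f i j oi oj → trans (f i oi) (sym (f j oj)))

pa-ind-passive : ∀ F s a t Γ Δ → ¬ OccSeq s a (Γ ⇒ Δ) →
  MVLKIE-EFree (psubSeq passive (F ∷ Γ ⇒ Δ ∷ʳ psubF (single s a (`s (par s a))) F)) →
  MVLKIE-EFree (psubSeq passive (psubF (single s a `0) F ∷ Γ ⇒ Δ ∷ʳ psubF (single s a t) F))
pa-ind-passive F s a t Γ Δ a∉ d =
  OnlyZero.cast antecedent≡ succedent≡
    (ind H 0 [] (psubT passive t) Γ' Δ' 0∉ [] oneActive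
      (OnlyZero.cast (cong (H ∷_) (map-psubF-single-∉ pas b n Γ' (b∉ ∘ inj₁))) ψΔ₊≡
        (OnlyZero.single-admissible pas b n refl
          (passive-within (F ∷ Γ)) (passive-within Δ₊) (ψ-within (F ∷ Γ)) (ψ-within Δ₊) d)))
  where
  b  = encode s a
  n  = par act 0
  G  = passiveF F
  Γ' = passiveL Γ
  Δ' = passiveL Δ
  Δ₊ = Δ ∷ʳ psubF (single s a (`s (par s a))) F
  ψ  = psubF (single pas b n)
  H  = ψ G
  X  = psubF (single pas b (`s (par pas b))) G

  b∉ : ¬ OccSeq pas b (Γ' ⇒ Δ')
  b∉ = a∉ ∘ occSeq-passive⁻ Γ Δ
  0∉ : ¬ OccSeq act 0 (Γ' ⇒ Δ')
  0∉ = [ act∉passiveL Γ , act∉passiveL Δ ]′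

  passive-within : ∀ L → OnlyZero.Withins (passiveL L)
  passive-within L = OnlyZero.withins-¬act _ (act∉passiveL L)

  ψ-within : ∀ L → OnlyZero.Withins (map ψ (passiveL L))
  ψ-within L = OnlyZero.withins-psub _ (passiveL L) image
    where
    image : OnlyZero.ImageWithin (single pas b n) (passiveL L)
    image s' j oc i o with occ-single {pas} {b} {n} {s'} {j} o
    ... | inj₁ here       = refl
    ... | inj₂ (refl , _) = ⊥-elim (act∉passiveL L oc)

  ψX≡ : ψ X ≡ psubF (single act 0 (`s n)) H
  ψX≡ = begin
    ψ X
      ≡⟨ psubF-single-single pas b n _ G ⟩
    psubF (single pas b (psubT (single pas b n) (`s (par pas b)))) G
      ≡⟨ cong (λ w → psubF (single pas b (`s w)) G) (trans (psubT-par (single pas b n) pas b) (single-hit pas b n)) ⟩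
    psubF (single pas b (`s n)) G
      ≡⟨ sym (psubF-single-via-act _ b 0 G (λ i → act∉passiveF F)
                λ { act j ne → ⊥-elim (ne refl) ; pas j _ → refl ; int j _ → refl }) ⟩
    psubF (single act 0 (`s n)) H ∎
    where open ≡-Reasoning

  ψΔ₊≡ : map ψ (passiveL Δ₊) ≡ Δ' ∷ʳ psubF (single act 0 (`s n)) H
  ψΔ₊≡ = begin
    map ψ (passiveL Δ₊)
      ≡⟨ cong (map ψ) (trans (passiveL-∷ʳ Δ _) (cong (Δ' ∷ʳ_) (passiveF-single s a _ F))) ⟩
    map ψ (Δ' ∷ʳ X)
      ≡⟨ map-++ ψ Δ' [ X ] ⟩
    map ψ Δ' ∷ʳ ψ X
      ≡⟨ cong₂ _∷ʳ_ (map-psubF-single-∉ pas b n Δ' (b∉ ∘ inj₂)) ψX≡ ⟩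
    Δ' ∷ʳ psubF (single act 0 (`s n)) H ∎
    where open ≡-Reasoning

  H[_]≡ : ∀ w → psubF (indSub 0 (psubT passive w) []) H ≡ passiveF (psubF (single s a w) F)
  H[ w ]≡ = trans (psubF-single-via-act _ b 0 G (λ i → act∉passiveF F) fixes) (sym (passiveF-single s a w F))
    where
    fixes : ∀ s j → s ≢ act → indSub 0 (psubT passive w) [] s j ≡ par s j
    fixes act j ne = ⊥-elim (ne refl)
    fixes pas j _  = refl
    fixes int j _  = refl

  antecedent≡ : psubF (indSub 0 `0 []) H ∷ Γ' ≡ passiveL (psubF (single s a `0) F ∷ Γ)
  antecedent≡ = cong (_∷ Γ') (H[_]≡ `0)

  succedent≡ : Δ' ∷ʳ psubF (indSub 0 (psubT passive t) []) H ≡ passiveL (Δ ∷ʳ psubF (single s a t) F)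
  succedent≡ = trans (cong (Δ' ∷ʳ_) (H[_]≡ t)) (sym (passiveL-∷ʳ Δ _))

  oneActive : OneActive (psubF (indSub 0 `0 []) H ∷ Γ' ⇒ Δ' ∷ʳ psubF (indSub 0 (psubT passive t) []) H)
  oneActive = subst OneActive (sym (cong₂ _⇒_ antecedent≡ succedent≡)) (oneActive-passive _)

pa⇒passive : ∀ {S} → PAProof S → MVLKIE-EFree (psubSeq passive S)
pa⇒passive* : ∀ {ps} → All PAProof ps → All MVLKIE-EFree (map (psubSeq passive) ps)
pa⇒passive (rule r ds)              = rule (Rule-passive r) (oneActive-passive _) (pa⇒passive* ds)
pa⇒passive (ind F s a t Γ Δ a∉ d) = pa-ind-passive F s a t Γ Δ a∉ (pa⇒passive d)
pa⇒passive* []       = []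
pa⇒passive* (d ∷ ds) = pa⇒passive d ∷ pa⇒passive* ds

unpassive-passiveL : ∀ L → map (psubF unpassive) (passiveL L) ≡ L
unpassive-passiveL []      = refl
unpassive-passiveL (A ∷ L) = cong₂ _∷_ (unpassive-passive A) (unpassive-passiveL L)

occ-unpassive : ∀ {i j} L → OccL pas i (passiveL L) → OccT act j (unpassive pas i) → OccL act j L
occ-unpassive L o oj with occL-psub⁻ passive L o
... | s , k , oc , oi with occ-par oi
...   | refl with occ-par (subst (λ p → OccT act _ (par (proj₁ p) (proj₂ p))) (decode-encode s k) oj)
...     | refl = oc

pa⇒mvlkie : ∀ S → OneActive S → PAProof S → MVLKIE-EFree S
pa⇒mvlkie (Γ ⇒ Δ) oneAct p =
  Back.cast (unpassive-passiveL Γ) (unpassive-passiveL Δ)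
    (Back.psub-admissible Ps (All-map⁺ (All.universal (λ _ → refl) _)) Γ' Δ' unpassive moves image
      (Back.withins-¬act Γ' (act∉passiveL Γ)) (Back.withins-¬act Δ' (act∉passiveL Δ)) (pa⇒passive p))
  where
  module Back = Admissible MV (λ i → OccSeq act i (Γ ⇒ Δ)) (λ f i j oi oj → oneAct i j (f i oi) (f j oj))
  Γ' = passiveL Γ
  Δ' = passiveL Δ
  Ps = map (pas ,_) (upTo (fresh (Γ' ++ Δ')))

  moves : MovesOnly unpassive Ps (Γ' ++ Δ')
  moves act _ _ _   = refl
  moves int _ _ _   = refl
  moves pas i o ∉Ps = ⊥-elim (∉Ps (∈-map⁺ (pas ,_) (∈-upTo⁺ (s≤s (occ⇒≤maxL (Γ' ++ Δ') o)))))

  image : Back.ImageWithin unpassive (Γ' ++ Δ')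
  image act i o = ⊥-elim ([ act∉passiveL Γ , act∉passiveL Δ ]′ (Any-++⁻ Γ' o))
  image int i o j ()
  image pas i o j oj = ⊎-map (λ o → occ-unpassive Γ o oj) (λ o → occ-unpassive Δ o oj) (Any-++⁻ Γ' o)

theorem5 : ∀ (S : Seq) → OneActive S → (MVLKIE-EFree S ⇔ PAProof S)
theorem5 S oneAct = mk⇔ mvlkie⇒pa (pa⇒mvlkie S oneAct)
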